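{- Let $P$ be a set of permutation patterns, let $w\in S^P$ and let $h$ be a permutation. If $w$ heap-contains $h$, then $w$ contains some element of $U^P(h)$ as a 1-line pattern.
   Context: A permutation $w=[w_1\cdots w_n]$ contains $p=[p_1\cdots p_k]\in S_k$ as a 1-line pattern if there are $i_1<\dots<i_k$ with $w_{i_a}<w_{i_b}$ iff $p_a<p_b$ for all $a<b$. $S^P=\bigcup_{n\ge1}S^P_n$ is the set of permutations avoiding every pattern in $P$, $S^P_n=S^P\cap S_n$. $S_n$ is the Coxeter group with generators $s_1,\dots,s_{n-1}$. The heap of a reduced expression $\mathsf{w}_1\cdots\mathsf{w}_k$ is $\{1,\dots,k\}$ with the order generated by $i\lessdot j$ if $i<j$ and $\mathsf{w}_i,\mathsf{w}_j$ do not commute, labeled by $\mathsf{w}_i$. An orientation preserving Coxeter embedding $f:\{s_1,\dots,s_{k-1}\}\to\{s_1,\dots,s_{n-1}\}$ is an injective map such that for $m\in\{2,3\}$, $(s_is_j)^m=1$ iff $(f(s_i)f(s_j))^m=1$, and the index of $f(s_i)$ is less than that of $f(s_j)$ when $i<j$; extended to words. $w$ heap-contains $h$ if there are reduced expressions $\mathsf{w}$ of $w$, $\mathsf{h}$ of $h$ and such an $f$ with the heap of $f(\mathsf{h})$ a convex labeled subposet of the heap of $\mathsf{w}$. For $h\in S_r$ write $r(h)=r$; $U^P(h)$ is the set of elements of $S^P_{r(h)}$ that heap-contain $h$. -}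

module Defs where

open import Data.Nat using (ℕ; zero; suc; _∸_; _≤_; _<?_)
import Data.Nat as ℕ
open import Data.Fin using (Fin; toℕ; fromℕ<)
import Data.Fin as F
open import Data.Fin.Permutation using (Permutation′; _⟨$⟩ʳ_; _∘ₚ_; transpose) renaming (id to idₚ)
open import Data.List using (List; []; _∷_; length; lookup; map; replicate; concat)
open import Data.List.Relation.Unary.All using (All)
open import Data.Product using (Σ; ∃; _×_; _,_)
open import Relation.Nullary using (¬_; yes; no)
open import Relation.Binary.PropositionalEquality using (_≡_)
open import Relation.Binary.Construct.Closure.ReflexiveTransitive using (Star)

-- Permutations of [n] (the symmetric group S_n), as bijections of Fin n.
-- w(i) is  w ⟨$⟩ʳ i ; one-line notation [w(0) ... w(n-1)] (0-based).

Perm : ℕ → Set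
Perm = Permutation′

_≈ₚ_ : ∀ {n} → Perm n → Perm n → Set
π ≈ₚ ρ = ∀ i → π ⟨$⟩ʳ i ≡ ρ ⟨$⟩ʳ i

-- group product as composition of functions: (π · ρ)(x) = π(ρ(x))
_·_ : ∀ {n} → Perm n → Perm n → Perm n
π · ρ = ρ ∘ₚ π

Contains : ∀ {n k} → Perm n → Perm k → Set
Contains {n} {k} w p =
  Σ (Fin k → Fin n) λ ι →
    (∀ a b → a F.< b → ι a F.< ι b) ×
    (∀ a b → a F.< b →
       ((w ⟨$⟩ʳ ι a) F.< (w ⟨$⟩ʳ ι b) → (p ⟨$⟩ʳ a) F.< (p ⟨$⟩ʳ b)) ×
       ((p ⟨$⟩ʳ a) F.< (p ⟨$⟩ʳ b) → (w ⟨$⟩ʳ ι a) F.< (w ⟨$⟩ʳ ι b)))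

PatternSet : Set₁
PatternSet = (k : ℕ) → Perm k → Set

Avoids : PatternSet → ∀ {n} → Perm n → Set
Avoids P w = ∀ k (p : Perm k) → P k p → ¬ Contains w p

-- Coxeter generators s_1, ..., s_{n-1} of S_n (1-based indices, as in
-- the paper): s_i is the transposition of the values i and i+1, i.e. of
-- the 0-based elements i-1 and i of Fin n.  For indices outside
-- 1 ≤ i ≤ n-1 we return the identity (such indices are excluded by
-- ValidWord wherever it matters).

gen : (n : ℕ) → ℕ → Perm n
gen n zero = idₚ
gen n (suc j) with suc j <? n
... | yes p = transpose (fromℕ< (ℕ.≤-trans (ℕ.n≤1+n (suc j)) p)) (fromℕ< p)
  where import Data.Nat.Properties as ℕ
... | no _ = idₚ

ValidWord : ℕ → List ℕ → Set
ValidWord n ws = All (λ i → (1 ℕ.≤ i) × (i ℕ.< n)) ws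

prod : (n : ℕ) → List ℕ → Perm n
prod n []       = idₚ
prod n (i ∷ ws) = gen n i · prod n ws

IsReducedExpr : ∀ {n} → Perm n → List ℕ → Set
IsReducedExpr {n} w ws =
  ValidWord n ws × (prod n ws ≈ₚ w) ×
  (∀ vs → ValidWord n vs → prod n vs ≈ₚ w → length ws ℕ.≤ length vs)

Commute : ℕ → ℕ → ℕ → Set
Commute n i j = prod n (i ∷ j ∷ []) ≈ₚ prod n (j ∷ i ∷ [])

HeapCover : ℕ → (ws : List ℕ) → Fin (length ws) → Fin (length ws) → Set
HeapCover n ws a b = (a F.< b) × ¬ Commute n (lookup ws a) (lookup ws b)

HeapLe : ℕ → (ws : List ℕ) → Fin (length ws) → Fin (length ws) → Set
HeapLe n ws = Star (HeapCover n ws)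

ConvexLabeledSubheap : ℕ → (us ws : List ℕ) → Set
ConvexLabeledSubheap n us ws =
  Σ (Fin (length us) → Fin (length ws)) λ φ →
    (∀ a b → φ a ≡ φ b → a ≡ b) ×
    (∀ a → lookup ws (φ a) ≡ lookup us a) ×
    (∀ a b → (HeapLe n us a b → HeapLe n ws (φ a) (φ b)) ×
             (HeapLe n ws (φ a) (φ b) → HeapLe n us a b)) ×
    (∀ a b x → HeapLe n ws (φ a) x → HeapLe n ws x (φ b) →
       Σ (Fin (length us)) λ c → φ c ≡ x)

CoxRel : (n m i j : ℕ) → Set
CoxRel n m i j = prod n (concat (replicate m (i ∷ j ∷ []))) ≈ₚ idₚ

InRange : ℕ → ℕ → Set
InRange n i = (1 ℕ.≤ i) × (i ℕ.< n)

IsOrientedCoxeterEmbedding : (k n : ℕ) → (ℕ → ℕ) → Set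
IsOrientedCoxeterEmbedding k n f =
  (∀ i → InRange k i → InRange n (f i)) ×
  (∀ i j → InRange k i → InRange k j → f i ≡ f j → i ≡ j) ×
  (∀ i j → InRange k i → InRange k j →
     (CoxRel k 2 i j → CoxRel n 2 (f i) (f j)) ×
     (CoxRel n 2 (f i) (f j) → CoxRel k 2 i j) ×
     (CoxRel k 3 i j → CoxRel n 3 (f i) (f j)) ×
     (CoxRel n 3 (f i) (f j) → CoxRel k 3 i j)) ×
  (∀ i j → InRange k i → InRange k j → i ℕ.< j → f i ℕ.< f j)

HeapContains : ∀ {n r} → Perm n → Perm r → Set
HeapContains {n} {r} w h =
  Σ (List ℕ) λ ws → Σ (List ℕ) λ hs → Σ (ℕ → ℕ) λ f →
    IsReducedExpr w ws × IsReducedExpr h hs ×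
    IsOrientedCoxeterEmbedding r n f ×
    ConvexLabeledSubheap n (map f hs) ws

InU : PatternSet → ∀ {r} → Perm r → Perm r → Set
InU P h u = Avoids P u × HeapContains u h

-- An orientation preserving Coxeter embedding shifts generator indices: f i = c + i. Take a reduced
-- word of w in which the heap of f(h) is a convex subheap C. The letters lying below C in the heap
-- commute past the rest of the word to the left of C, and the remaining ones to its right, giving a
-- reduced word L C R of w. Read in S_r, C - c is a reduced word of some u₀, which occurs in w at the
-- positions c, …, c + r - 1. Lengths are numbers of inversions, so putting back the letters of L and R
-- one at a time raises the length by one at each step; the current pattern u then either still occurs,
-- or the step exchanges two entries of the occurrence and u times the corresponding generator of S_r,
-- again one longer, occurs instead. The final u has a reduced word with C - c as a contiguous factor,
-- so it heap-contains h, and it avoids P since pattern containment is transitive.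

module Submission where

open import Defs
open import Data.Nat using (ℕ; zero; suc; _+_; _∸_; _*_; _≤_; _<_; _<?_; _≤?_; z≤n; s≤s)
open import Data.Nat.Properties
open import Data.Bool using (Bool; true; false)
open import Data.Fin as F using (Fin; toℕ; fromℕ<)
open import Data.Fin.Properties as FP using (toℕ-fromℕ<; toℕ-injective; punchInᵢ≢i; toℕ-cast; cast-involutive)
open import Data.Fin.Permutation using (_⟨$⟩ʳ_; _⟨$⟩ˡ_; flip; inverseʳ; inverseˡ) renaming (id to idₚ)
import Data.Fin.Permutation.Components as PC
open import Data.List using (List; []; _∷_; _++_; foldr; length; lookup; map)
open import Data.List.Properties using (length-++; ++-assoc; ++-identityʳ; length-map; map-∘; map-id; map-id-local)
open import Data.List.Relation.Unary.All as All using (All; []; _∷_)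
open import Data.List.Relation.Unary.All.Properties using (++⁺; ++⁻ˡ; ++⁻ʳ; map⁺)
open import Data.List.Membership.Propositional.Properties using (∈-lookup)
open import Data.List.Relation.Binary.Permutation.Propositional using (_↭_; ↭-refl; ↭-prep; ↭-trans; ↭-reflexive; ↭-sym)
open import Data.List.Relation.Binary.Permutation.Propositional.Properties as ↭ using (All-resp-↭; ↭-length)
open import Data.List.Reverse using (Reverse; []; _∶_∶ʳ_; reverseView)
open import Data.Product using (Σ; _×_; _,_; proj₁; proj₂)
open import Data.Sum using (_⊎_; inj₁; inj₂; [_,_]′)
open import Data.Empty using (⊥-elim)
open import Relation.Nullary using (¬_; yes; no; Dec; does; contradiction)
open import Relation.Nullary.Decidable using (dec-true; dec-false; _×-dec_)
open import Relation.Binary.Definitions using (tri<; tri≈; tri>)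
open import Relation.Binary.PropositionalEquality
open import Relation.Binary.Construct.Closure.ReflexiveTransitive using (Star; ε; _◅_; gmap)
open import Function using (_∘_; id; _⇔_; mk⇔; Equivalence)
import Function.Properties.Equivalence as ⇔
open import Algebra.Properties.CommutativeMonoid.Sum +-0-commutativeMonoid
  using (sum; sum-remove; sum-cong-≗; sum-replicate-zero; ∑-comm; sum-permute)

-- Adjacent transpositions

-- The action of s_i on 0-based values: it exchanges i - 1 and i (and, like gen, is the identity
-- for i = 0).
swapℕ : ℕ → ℕ → ℕ
swapℕ zero    y = y
swapℕ (suc j) y with y ≟ j
... | yes _ = suc j
... | no _ with y ≟ suc j
...   | yes _ = j
...   | no _  = y

data SwapView (j y : ℕ) : ℕ → Set where
  at-j   : y ≡ j → SwapView j y (suc j)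
  at-1+j : y ≡ suc j → SwapView j y j
  other  : y ≢ j → y ≢ suc j → SwapView j y y

swap-view : ∀ j y → SwapView j y (swapℕ (suc j) y)
swap-view j y with y ≟ j
... | yes y≡j = at-j y≡j
... | no y≢j with y ≟ suc j
...   | yes y≡1+j = at-1+j y≡1+j
...   | no y≢1+j  = other y≢j y≢1+j

swap-j : ∀ j → swapℕ (suc j) j ≡ suc j
swap-j j with swapℕ (suc j) j | swap-view j j
... | _ | at-j _       = refl
... | _ | at-1+j j≡1+j = contradiction (sym j≡1+j) 1+n≢n
... | _ | other j≢j _  = contradiction refl j≢j

swap-1+j : ∀ j → swapℕ (suc j) (suc j) ≡ j
swap-1+j j with swapℕ (suc j) (suc j) | swap-view j (suc j)
... | _ | at-j 1+j≡j  = contradiction 1+j≡j 1+n≢n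
... | _ | at-1+j _    = refl
... | _ | other _ ne  = contradiction refl ne

swap-other : ∀ j y → y ≢ j → y ≢ suc j → swapℕ (suc j) y ≡ y
swap-other j y y≢j y≢1+j with swapℕ (suc j) y | swap-view j y
... | _ | at-j y≡j     = contradiction y≡j y≢j
... | _ | at-1+j y≡1+j = contradiction y≡1+j y≢1+j
... | _ | other _ _    = refl

swap-involutive : ∀ i y → swapℕ i (swapℕ i y) ≡ y
swap-involutive zero    y = refl
swap-involutive (suc j) y with swapℕ (suc j) y | swap-view j y
... | _ | at-j refl   = swap-1+j j
... | _ | at-1+j refl = swap-j j
... | _ | other ne ne′ = swap-other j y ne ne′

swap-+ : ∀ c j y → swapℕ (c + suc j) (c + y) ≡ c + swapℕ (suc j) y
swap-+ c j y rewrite +-suc c j with swapℕ (suc j) y | swap-view j y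
... | _ | at-j refl   = trans (swap-j (c + j)) (sym (+-suc c j))
... | _ | at-1+j refl rewrite +-suc c j = swap-1+j (c + j)
... | _ | other ne ne′ = swap-other (c + j) (c + y) (ne ∘ +-cancelˡ-≡ c _ _)
                           (ne′ ∘ +-cancelˡ-≡ c _ _ ∘ (λ e → trans e (sym (+-suc c j))))

swap-fix-< : ∀ j {y} → y < j → swapℕ (suc j) y ≡ y
swap-fix-< j y<j = swap-other j _ (<⇒≢ y<j) (<⇒≢ (m<n⇒m<1+n y<j))

swap-fix-> : ∀ j {y} → suc j < y → swapℕ (suc j) y ≡ y
swap-fix-> j 1+j<y = swap-other j _ (>⇒≢ (<-trans (n<1+n j) 1+j<y)) (>⇒≢ 1+j<y)

swap-mono-< : ∀ j {α β} → α < β → ¬ (α ≡ j × β ≡ suc j) → swapℕ (suc j) α < swapℕ (suc j) β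
swap-mono-< j {α} {β} α<β ¬jump with swapℕ (suc j) α | swap-view j α | swapℕ (suc j) β | swap-view j β
... | _ | at-j refl     | _ | at-j refl     = contradiction α<β (<-irrefl refl)
... | _ | at-j refl     | _ | at-1+j refl   = contradiction (refl , refl) ¬jump
... | _ | at-j refl     | _ | other _ β≢1+j = ≤∧≢⇒< α<β (β≢1+j ∘ sym)
... | _ | at-1+j refl   | _ | at-j refl     = contradiction α<β (<-asym (n<1+n j))
... | _ | at-1+j refl   | _ | at-1+j refl   = contradiction α<β (<-irrefl refl)
... | _ | at-1+j refl   | _ | other _ _     = <-trans (n<1+n j) α<β
... | _ | other _ _     | _ | at-j refl     = <-trans α<β (n<1+n j)
... | _ | other α≢j _   | _ | at-1+j refl   = ≤∧≢⇒< (≤-pred α<β) α≢j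
... | _ | other _ _     | _ | other _ _     = α<β

swap-reflects-< : ∀ j {α β} → swapℕ (suc j) α < swapℕ (suc j) β → ¬ (α ≡ suc j × β ≡ j) → α < β
swap-reflects-< j {α} {β} lt ¬jump =
  subst₂ _<_ (swap-involutive (suc j) α) (swap-involutive (suc j) β) (swap-mono-< j lt ¬jump′)
  where
  ¬jump′ : ¬ (swapℕ (suc j) α ≡ j × swapℕ (suc j) β ≡ suc j)
  ¬jump′ (α′≡j , β′≡1+j) = ¬jump
    ( trans (sym (swap-involutive (suc j) α)) (trans (cong (swapℕ (suc j)) α′≡j) (swap-j j))
    , trans (sym (swap-involutive (suc j) β)) (trans (cong (swapℕ (suc j)) β′≡1+j) (swap-1+j j)))

swap-far : ∀ i k y → suc (suc i) ≤ k →
           swapℕ (suc i) (swapℕ (suc k) y) ≡ swapℕ (suc k) (swapℕ (suc i) y)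
swap-far i k y 2+i≤k with swapℕ (suc i) y | swap-view i y
... | _ | at-j refl =
  trans (cong (swapℕ (suc i)) (swap-fix-< k i<k)) (trans (swap-j i) (sym (swap-fix-< k 2+i≤k)))
  where i<k = <-trans (n<1+n i) 2+i≤k
... | _ | at-1+j refl =
  trans (cong (swapℕ (suc i)) (swap-fix-< k 2+i≤k)) (trans (swap-1+j i) (sym (swap-fix-< k i<k)))
  where i<k = <-trans (n<1+n i) 2+i≤k
... | _ | other y≢i y≢1+i with swapℕ (suc k) y | swap-view k y
...   | _ | at-j refl   = swap-fix-> i (<-trans 2+i≤k (n<1+n k))
...   | _ | at-1+j refl = swap-fix-> i 2+i≤k
...   | _ | other _ _   = swap-other i y y≢i y≢1+i

Adjacent : ℕ → ℕ → Set
Adjacent i j = suc i ≡ j ⊎ suc j ≡ i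

adjacent? : ∀ i j → Dec (Adjacent i j)
adjacent? i j with suc i ≟ j | suc j ≟ i
... | yes e | _     = yes (inj₁ e)
... | no _  | yes e = yes (inj₂ e)
... | no a  | no b  = no λ { (inj₁ e) → a e ; (inj₂ e) → b e }

adjacent-+ : ∀ c {x y} → Adjacent x y → Adjacent (c + x) (c + y)
adjacent-+ c (inj₁ 1+x≡y) = inj₁ (trans (sym (+-suc c _)) (cong (c +_) 1+x≡y))
adjacent-+ c (inj₂ 1+y≡x) = inj₂ (trans (sym (+-suc c _)) (cong (c +_) 1+y≡x))

+-adjacent : ∀ c {x y} → Adjacent (c + x) (c + y) → Adjacent x y
+-adjacent c (inj₁ e) = inj₁ (+-cancelˡ-≡ c _ _ (trans (+-suc c _) e))
+-adjacent c (inj₂ e) = inj₂ (+-cancelˡ-≡ c _ _ (trans (+-suc c _) e))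

swap-comm : ∀ a b y → ¬ Adjacent a b → swapℕ a (swapℕ b y) ≡ swapℕ b (swapℕ a y)
swap-comm zero    b       y _ = refl
swap-comm (suc i) zero    y _ = refl
swap-comm (suc i) (suc k) y ¬adj with <-cmp i k
... | tri< i<k _ _ = swap-far i k y (≤∧≢⇒< i<k (¬adj ∘ inj₁ ∘ cong suc))
... | tri≈ _ refl _ = refl
... | tri> _ _ k<i = sym (swap-far k i y (≤∧≢⇒< k<i (¬adj ∘ inj₂ ∘ cong suc)))

transpose-toℕ : ∀ {n} {a b : Fin n} {j} → toℕ a ≡ j → toℕ b ≡ suc j →
                ∀ x → toℕ (PC.transpose a b x) ≡ swapℕ (suc j) (toℕ x)
transpose-toℕ {a = a} {b} {j} a≡j b≡1+j x with x F.≟ a | x F.≟ b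
... | yes refl | _ =
  trans b≡1+j (sym (trans (cong (swapℕ (suc j)) a≡j) (swap-j j)))
... | no x≢a | yes refl rewrite dec-true (x F.≟ x) refl =
  trans a≡j (sym (trans (cong (swapℕ (suc j)) b≡1+j) (swap-1+j j)))
... | no x≢a | no x≢b rewrite dec-false (x F.≟ b) x≢b =
  sym (swap-other j (toℕ x) (x≢a ∘ toℕ-injective ∘ (λ e → trans e (sym a≡j)))
                            (x≢b ∘ toℕ-injective ∘ (λ e → trans e (sym b≡1+j))))

gen-toℕ : ∀ {n i} → InRange n i → ∀ x → toℕ (gen n i ⟨$⟩ʳ x) ≡ swapℕ i (toℕ x)
gen-toℕ {i = zero} (() , _)
gen-toℕ {n} {suc j} (_ , 1+j<n) x with suc j <? n
... | yes 1+j<n′ = transpose-toℕ (toℕ-fromℕ< _) (toℕ-fromℕ< 1+j<n′) x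
... | no 1+j≮n   = contradiction 1+j<n 1+j≮n

gen-involutive : ∀ n i x → gen n i ⟨$⟩ʳ (gen n i ⟨$⟩ʳ x) ≡ x
gen-involutive n zero    x = refl
gen-involutive n (suc j) x with suc j <? n
... | no _       = refl
... | yes 1+j<n = toℕ-injective (begin
  toℕ (PC.transpose a b (PC.transpose a b x)) ≡⟨ transpose-toℕ a≡j b≡1+j (PC.transpose a b x) ⟩
  swapℕ (suc j) (toℕ (PC.transpose a b x))    ≡⟨ cong (swapℕ (suc j)) (transpose-toℕ a≡j b≡1+j x) ⟩
  swapℕ (suc j) (swapℕ (suc j) (toℕ x))       ≡⟨ swap-involutive (suc j) (toℕ x) ⟩
  toℕ x                                        ∎)
  where
  open ≡-Reasoning
  a b : Fin n
  a = fromℕ< (<-trans (n<1+n j) 1+j<n)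
  b = fromℕ< 1+j<n
  a≡j = toℕ-fromℕ< (<-trans (n<1+n j) 1+j<n)
  b≡1+j = toℕ-fromℕ< 1+j<n

swaps : List ℕ → ℕ → ℕ
swaps ws y = foldr swapℕ y ws

prod-toℕ : ∀ {n ws} → ValidWord n ws → ∀ x → toℕ (prod n ws ⟨$⟩ʳ x) ≡ swaps ws (toℕ x)
prod-toℕ {ws = []}     []         x = refl
prod-toℕ {ws = i ∷ ws} (vi ∷ vws) x = trans (gen-toℕ vi _) (cong (swapℕ i) (prod-toℕ vws x))

prod-++ : ∀ n xs ys → prod n (xs ++ ys) ≈ₚ (prod n xs · prod n ys)
prod-++ n []       ys x = refl
prod-++ n (i ∷ xs) ys x = cong (gen n i ⟨$⟩ʳ_) (prod-++ n xs ys x)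

¬adjacent⇒commute : ∀ {n i j} → InRange n i → InRange n j → ¬ Adjacent i j → Commute n i j
¬adjacent⇒commute {n} {i} {j} vi vj ¬adj x = toℕ-injective (begin
  toℕ (prod n (i ∷ j ∷ []) ⟨$⟩ʳ x) ≡⟨ prod-toℕ (vi ∷ vj ∷ []) x ⟩
  swapℕ i (swapℕ j (toℕ x))        ≡⟨ swap-comm i j (toℕ x) ¬adj ⟩
  swapℕ j (swapℕ i (toℕ x))        ≡⟨ prod-toℕ (vj ∷ vi ∷ []) x ⟨
  toℕ (prod n (j ∷ i ∷ []) ⟨$⟩ʳ x) ∎)
  where open ≡-Reasoning

-- Evaluate both products at the value i - 1, which s_i s_{i+1} sends to i and s_{i+1} s_i to i + 1.
adjacent⇒¬commute : ∀ {n i j} → InRange n i → InRange n j → Adjacent i j → ¬ Commute n i j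
adjacent⇒¬commute {i = zero} (() , _)
adjacent⇒¬commute {n} {suc i} vi vj (inj₁ refl) commute = 1+n≢n (sym (trans (sym s₁s₂x) (trans (cong toℕ (commute x)) s₂s₁x)))
  where
  open ≡-Reasoning
  x = fromℕ< (<-trans (n<1+n i) (proj₂ vi))
  x≡i = toℕ-fromℕ< (<-trans (n<1+n i) (proj₂ vi))
  s₁s₂x : toℕ (prod n (suc i ∷ suc (suc i) ∷ []) ⟨$⟩ʳ x) ≡ suc i
  s₁s₂x = begin
    toℕ (prod n (suc i ∷ suc (suc i) ∷ []) ⟨$⟩ʳ x) ≡⟨ prod-toℕ (vi ∷ vj ∷ []) x ⟩
    swapℕ (suc i) (swapℕ (suc (suc i)) (toℕ x))    ≡⟨ cong (λ y → swapℕ (suc i) (swapℕ (suc (suc i)) y)) x≡i ⟩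
    swapℕ (suc i) (swapℕ (suc (suc i)) i)          ≡⟨ cong (swapℕ (suc i)) (swap-fix-< (suc i) (n<1+n i)) ⟩
    swapℕ (suc i) i                                ≡⟨ swap-j i ⟩
    suc i                                          ∎
  s₂s₁x : toℕ (prod n (suc (suc i) ∷ suc i ∷ []) ⟨$⟩ʳ x) ≡ suc (suc i)
  s₂s₁x = begin
    toℕ (prod n (suc (suc i) ∷ suc i ∷ []) ⟨$⟩ʳ x) ≡⟨ prod-toℕ (vj ∷ vi ∷ []) x ⟩
    swapℕ (suc (suc i)) (swapℕ (suc i) (toℕ x))    ≡⟨ cong (λ y → swapℕ (suc (suc i)) (swapℕ (suc i) y)) x≡i ⟩
    swapℕ (suc (suc i)) (swapℕ (suc i) i)          ≡⟨ cong (swapℕ (suc (suc i))) (swap-j i) ⟩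
    swapℕ (suc (suc i)) (suc i)                    ≡⟨ swap-j (suc i) ⟩
    suc (suc i)                                    ∎
adjacent⇒¬commute vi vj (inj₂ refl) commute = adjacent⇒¬commute vj vi (inj₁ refl) (sym ∘ commute)

commute⇔¬adjacent : ∀ {n i j} → InRange n i → InRange n j → Commute n i j ⇔ (¬ Adjacent i j)
commute⇔¬adjacent vi vj = mk⇔ (λ commute adj → adjacent⇒¬commute vi vj adj commute) (¬adjacent⇒commute vi vj)

commute⇒coxRel₂ : ∀ {n i j} → Commute n i j → CoxRel n 2 i j
commute⇒coxRel₂ {n} {i} {j} commute x = begin
  sᵢ (sⱼ (sᵢ (sⱼ x))) ≡⟨ commute (sᵢ (sⱼ x)) ⟩
  sⱼ (sᵢ (sᵢ (sⱼ x))) ≡⟨ cong sⱼ (gen-involutive n i (sⱼ x)) ⟩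
  sⱼ (sⱼ x)           ≡⟨ gen-involutive n j x ⟩
  x                   ∎
  where
  open ≡-Reasoning
  sᵢ sⱼ : Fin n → Fin n
  sᵢ = gen n i ⟨$⟩ʳ_
  sⱼ = gen n j ⟨$⟩ʳ_

coxRel₂⇒commute : ∀ {n i j} → CoxRel n 2 i j → Commute n i j
coxRel₂⇒commute {n} {i} {j} coxRel x = begin
  sᵢ (sⱼ x)                     ≡⟨ cong sᵢ (cong sⱼ (gen-involutive n i x)) ⟨
  sᵢ (sⱼ (sᵢ (sᵢ x)))           ≡⟨ cong sᵢ (cong sⱼ (cong sᵢ (gen-involutive n j (sᵢ x)))) ⟨
  sᵢ (sⱼ (sᵢ (sⱼ (sⱼ (sᵢ x))))) ≡⟨ coxRel (sⱼ (sᵢ x)) ⟩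
  sⱼ (sᵢ x)                     ∎
  where
  open ≡-Reasoning
  sᵢ sⱼ : Fin n → Fin n
  sᵢ = gen n i ⟨$⟩ʳ_
  sⱼ = gen n j ⟨$⟩ʳ_

-- Images of adjacent generators are adjacent, since otherwise they would commute and, reflecting
-- (s s′)² = 1, so would the generators; the orientation excludes f (i + 1) = f i - 1.
coxeterEmbedding-adjacent : ∀ {r n f} → IsOrientedCoxeterEmbedding r n f →
  ∀ {i} → InRange r i → InRange r (suc i) → f (suc i) ≡ suc (f i)
coxeterEmbedding-adjacent {r} {n} {f} (inRange , _ , cox , increasing) {i} vi v1+i with adjacent? (f i) (f (suc i))
... | yes (inj₁ e) = sym e
... | yes (inj₂ e) = contradiction (increasing i (suc i) vi v1+i (n<1+n i)) (<-asym (subst (f (suc i) <_) e (n<1+n _)))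
... | no ¬adj = ⊥-elim (adjacent⇒¬commute vi v1+i (inj₁ refl) commuteᵣ)
  where
  commuteₙ : Commute n (f i) (f (suc i))
  commuteₙ = ¬adjacent⇒commute (inRange i vi) (inRange (suc i) v1+i) ¬adj
  commuteᵣ : Commute r i (suc i)
  commuteᵣ = coxRel₂⇒commute {r} {i} {suc i} (proj₁ (proj₂ (cox i (suc i) vi v1+i)) (commute⇒coxRel₂ {n} {f i} {f (suc i)} commuteₙ))

coxeterEmbedding-shift : ∀ {r n f} → 1 ≤ n → IsOrientedCoxeterEmbedding r n f →
  Σ ℕ λ c → (c + r ≤ n) × (∀ i → InRange r i → f i ≡ c + i)
coxeterEmbedding-shift {zero}        1≤n _ = 0 , z≤n , λ { _ (_ , ()) }
coxeterEmbedding-shift {suc zero}    1≤n _ = 0 , 1≤n , λ { i (1≤i , s≤s i≤0) → contradiction (≤-trans 1≤i i≤0) λ () }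
coxeterEmbedding-shift {suc (suc r)} {n} {f} 1≤n emb@(inRange , _) = c , c+r≤n , f≡c+
  where
  c = f 1 ∸ 1
  f≡c+ : ∀ i → InRange (suc (suc r)) i → f i ≡ c + i
  f≡c+ (suc zero)    _  = sym (m∸n+n≡m (proj₁ (inRange 1 (s≤s z≤n , s≤s (s≤s z≤n)))))
  f≡c+ (suc (suc i)) vi = begin
    f (suc (suc i)) ≡⟨ coxeterEmbedding-adjacent emb v1+i vi ⟩
    suc (f (suc i)) ≡⟨ cong suc (f≡c+ (suc i) v1+i) ⟩
    suc (c + suc i) ≡⟨ +-suc c (suc i) ⟨
    c + suc (suc i) ∎
    where
    open ≡-Reasoning
    v1+i = s≤s z≤n , <-trans (n<1+n (suc i)) (proj₂ vi)
  top : InRange (suc (suc r)) (suc r)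
  top = s≤s z≤n , n<1+n (suc r)
  c+r≤n : c + suc (suc r) ≤ n
  c+r≤n = subst (_≤ n) (trans (cong suc (f≡c+ (suc r) top)) (sym (+-suc c (suc r)))) (proj₂ (inRange (suc r) top))

-- Inversions and length

indicator : ∀ {A : Set} → Dec A → ℕ
indicator (yes _) = 1
indicator (no _)  = 0

indicator-yes : ∀ {A : Set} → A → (a? : Dec A) → indicator a? ≡ 1
indicator-yes a (yes _) = refl
indicator-yes a (no ¬a) = contradiction a ¬a

indicator-no : ∀ {A : Set} → ¬ A → (a? : Dec A) → indicator a? ≡ 0
indicator-no ¬a (yes a) = contradiction a ¬a
indicator-no ¬a (no _)  = refl

indicator-⇔ : ∀ {A B : Set} → (A → B) → (B → A) → (a? : Dec A) (b? : Dec B) → indicator a? ≡ indicator b?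
indicator-⇔ to from (yes a) b? = sym (indicator-yes (to a) b?)
indicator-⇔ to from (no ¬a) b? = sym (indicator-no (¬a ∘ from) b?)

sum-suc-at : ∀ {n} (f g : Fin n → ℕ) i₀ → (∀ i → i ≢ i₀ → f i ≡ g i) → f i₀ ≡ suc (g i₀) →
             sum f ≡ suc (sum g)
sum-suc-at {suc n} f g i₀ f≡g f≡1+g = begin
  sum f                        ≡⟨ sum-remove f ⟩
  f i₀ + sum (f ∘ F.punchIn i₀) ≡⟨ cong₂ _+_ f≡1+g (sum-cong-≗ (λ i → f≡g _ (punchInᵢ≢i i₀ i))) ⟩
  suc (g i₀) + sum (g ∘ F.punchIn i₀) ≡⟨ cong suc (sum-remove g) ⟨
  suc (sum g)                  ∎
  where open ≡-Reasoning

sum²-suc-at : ∀ {m n} (F G : Fin m → Fin n → ℕ) i₀ k₀ → (∀ i k → ¬ (i ≡ i₀ × k ≡ k₀) → F i k ≡ G i k) →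
              F i₀ k₀ ≡ suc (G i₀ k₀) → sum (sum ∘ F) ≡ suc (sum (sum ∘ G))
sum²-suc-at F G i₀ k₀ F≡G F≡1+G = sum-suc-at (sum ∘ F) (sum ∘ G) i₀
  (λ i i≢i₀ → sum-cong-≗ (λ k → F≡G i k (i≢i₀ ∘ proj₁)))
  (sum-suc-at (F i₀) (G i₀) k₀ (λ k k≢k₀ → F≡G i₀ k (k≢k₀ ∘ proj₂)) F≡1+G)

χ< : ∀ {n} → Fin n → Fin n → ℕ
χ< a b = indicator (a F.<? b)

inversion : ∀ {n} → Perm n → Fin n → Fin n → ℕ
inversion π i k = χ< i k * χ< (π ⟨$⟩ʳ k) (π ⟨$⟩ʳ i)

inversions : ∀ {n} → Perm n → ℕ
inversions π = sum (λ i → sum (inversion π i))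

inversions-cong : ∀ {n} {π ρ : Perm n} → π ≈ₚ ρ → inversions π ≡ inversions ρ
inversions-cong {π = π} {ρ} π≈ρ = sum-cong-≗ λ i → sum-cong-≗ λ k →
  cong (χ< i k *_) (cong₂ χ< (π≈ρ k) (π≈ρ i))

inversions-id : ∀ n → inversions (idₚ {n}) ≡ 0
inversions-id n = trans (sum-cong-≗ {n} {y = λ _ → 0} no-inversions) (sum-replicate-zero n)
  where
  no-inversion : ∀ i k → inversion idₚ i k ≡ 0
  no-inversion i k with i F.<? k
  ... | no _    = refl
  ... | yes i<k = cong (1 *_) (indicator-no (FP.<-asym i<k) (k F.<? i))
  no-inversions : ∀ i → sum (inversion idₚ i) ≡ 0
  no-inversions i = trans (sum-cong-≗ {n} {y = λ _ → 0} (no-inversion i)) (sum-replicate-zero n)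

inversions-flip : ∀ {n} (π : Perm n) → inversions (flip π) ≡ inversions π
inversions-flip {n} π = begin
  sum (λ i → sum (λ k → χ< i k * χ< (p⁻¹ k) (p⁻¹ i))) ≡⟨ sum-cong-≗ (λ i → sum-cong-≗ λ k → *-comm (χ< i k) (χ< (p⁻¹ k) (p⁻¹ i))) ⟩
  sum (λ i → sum (λ k → F i k))                        ≡⟨ ∑-comm F ⟩
  sum (λ k → sum (λ i → F i k))                        ≡⟨ sum-permute (λ k → sum (λ i → F i k)) π ⟩
  sum (λ k → sum (λ i → F i (p k)))                    ≡⟨ sum-cong-≗ (λ k → sum-permute (λ i → F i (p k)) π) ⟩
  sum (λ k → sum (λ i → F (p i) (p k)))                ≡⟨ sum-cong-≗ (λ k → sum-cong-≗ λ i →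
                                                            cong₂ (λ a b → χ< a b * χ< (p i) (p k)) (inverseˡ π) (inverseˡ π)) ⟩
  sum (λ k → sum (λ i → χ< k i * χ< (p i) (p k)))      ∎
  where
  open ≡-Reasoning
  p p⁻¹ : Fin n → Fin n
  p = π ⟨$⟩ʳ_
  p⁻¹ = π ⟨$⟩ˡ_
  F : Fin n → Fin n → ℕ
  F i k = χ< (p⁻¹ k) (p⁻¹ i) * χ< i k

perm-injective : ∀ {n} (π : Perm n) {x y} → toℕ (π ⟨$⟩ʳ x) ≡ toℕ (π ⟨$⟩ʳ y) → x ≡ y
perm-injective π {x} {y} e = trans (sym (inverseˡ π)) (trans (cong (π ⟨$⟩ˡ_) (toℕ-injective e)) (inverseˡ π))

-- Multiplying by s_{j+1} on the left exchanges the values j and j + 1, held at positions p and q: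
-- only the pair (p, q) changes its inversion status.
inversions-gen·-< : ∀ {n j} (π : Perm n) → InRange n (suc j) → ∀ {p q} →
             toℕ (π ⟨$⟩ʳ p) ≡ j → toℕ (π ⟨$⟩ʳ q) ≡ suc j → p F.< q →
             inversions (gen n (suc j) · π) ≡ suc (inversions π)
inversions-gen·-< {n} {j} π vj {p} {q} πp≡j πq≡1+j p<q =
  sum²-suc-at (inversion π′) (inversion π) p q unchanged changed
  where
  π′ = gen n (suc j) · π
  π′-toℕ : ∀ x → toℕ (π′ ⟨$⟩ʳ x) ≡ swapℕ (suc j) (toℕ (π ⟨$⟩ʳ x))
  π′-toℕ x = gen-toℕ vj (π ⟨$⟩ʳ x)
  π′q<π′p : π′ ⟨$⟩ʳ q F.< π′ ⟨$⟩ʳ p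
  π′q<π′p = subst₂ _<_ (sym (trans (π′-toℕ q) (trans (cong (swapℕ (suc j)) πq≡1+j) (swap-1+j j))))
                       (sym (trans (π′-toℕ p) (trans (cong (swapℕ (suc j)) πp≡j) (swap-j j)))) (n<1+n j)
  πq≮πp : ¬ (π ⟨$⟩ʳ q F.< π ⟨$⟩ʳ p)
  πq≮πp πq<πp = <-asym πq<πp (subst₂ _<_ (sym πp≡j) (sym πq≡1+j) (n<1+n j))
  changed : inversion π′ p q ≡ suc (inversion π p q)
  changed
    rewrite indicator-yes p<q (p F.<? q)
          | indicator-yes π′q<π′p ((π′ ⟨$⟩ʳ q) F.<? (π′ ⟨$⟩ʳ p))
          | indicator-no πq≮πp ((π ⟨$⟩ʳ q) F.<? (π ⟨$⟩ʳ p)) = refl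
  unchanged : ∀ i k → ¬ (i ≡ p × k ≡ q) → inversion π′ i k ≡ inversion π i k
  unchanged i k ¬pq with i F.<? k
  ... | no _    = refl
  ... | yes i<k = cong (1 *_) (indicator-⇔
    (λ lt → swap-reflects-< j (subst₂ _<_ (π′-toℕ k) (π′-toℕ i) lt)
              (λ (α≡1+j , β≡j) → ¬pq (perm-injective π (trans β≡j (sym πp≡j)) , perm-injective π (trans α≡1+j (sym πq≡1+j)))))
    (λ lt → subst₂ _<_ (sym (π′-toℕ k)) (sym (π′-toℕ i)) (swap-mono-< j lt
              (λ (α≡j , β≡1+j) → FP.<-asym p<q (subst₂ F._<_ (perm-injective π (trans β≡1+j (sym πq≡1+j)))
                                                             (perm-injective π (trans α≡j (sym πp≡j))) i<k))))
    _ _)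

inversions-gen·-> : ∀ {n j} (π : Perm n) → InRange n (suc j) → ∀ {p q} →
             toℕ (π ⟨$⟩ʳ p) ≡ j → toℕ (π ⟨$⟩ʳ q) ≡ suc j → q F.< p →
             suc (inversions (gen n (suc j) · π)) ≡ inversions π
inversions-gen·-> {n} {j} π vj {p} {q} πp≡j πq≡1+j q<p =
  trans (sym (inversions-gen·-< π′ vj π′q≡j π′p≡1+j q<p))
        (inversions-cong {π = gen n (suc j) · π′} {π} (λ x → gen-involutive n (suc j) (π ⟨$⟩ʳ x)))
  where
  π′ = gen n (suc j) · π
  π′q≡j : toℕ (π′ ⟨$⟩ʳ q) ≡ j
  π′q≡j = trans (gen-toℕ vj _) (trans (cong (swapℕ (suc j)) πq≡1+j) (swap-1+j j))
  π′p≡1+j : toℕ (π′ ⟨$⟩ʳ p) ≡ suc j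
  π′p≡1+j = trans (gen-toℕ vj _) (trans (cong (swapℕ (suc j)) πp≡j) (swap-j j))

inversions-·gen≡inversions-gen·flip : ∀ {n} (π : Perm n) i → inversions (π · gen n i) ≡ inversions (gen n i · flip π)
inversions-·gen≡inversions-gen·flip {n} π i =
  trans (sym (inversions-flip (π · gen n i))) (inversions-cong {π = flip (π · gen n i)} {gen n i · flip π} gen⁻¹≡gen)
  where
  gen⁻¹≡gen : ∀ x → gen n i ⟨$⟩ˡ (π ⟨$⟩ˡ x) ≡ gen n i ⟨$⟩ʳ (π ⟨$⟩ˡ x)
  gen⁻¹≡gen x = trans (sym (gen-involutive n i _)) (cong (gen n i ⟨$⟩ʳ_) (inverseʳ (gen n i)))

-- Reduced to multiplication on the left by passing to π⁻¹, which has as many inversions as π.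
inversions-·gen-< : ∀ {n j} (π : Perm n) → InRange n (suc j) → ∀ {p q} →
             toℕ p ≡ j → toℕ q ≡ suc j → π ⟨$⟩ʳ p F.< π ⟨$⟩ʳ q →
             inversions (π · gen n (suc j)) ≡ suc (inversions π)
inversions-·gen-< {n} {j} π vj p≡j q≡1+j πp<πq = begin
  inversions (π · gen n (suc j))        ≡⟨ inversions-·gen≡inversions-gen·flip π (suc j) ⟩
  inversions (gen n (suc j) · flip π)   ≡⟨ inversions-gen·-< (flip π) vj (trans (cong toℕ (inverseˡ π)) p≡j)
                                                          (trans (cong toℕ (inverseˡ π)) q≡1+j) πp<πq ⟩
  suc (inversions (flip π))             ≡⟨ cong suc (inversions-flip π) ⟩
  suc (inversions π)                    ∎
  where open ≡-Reasoning

inversions-·gen-> : ∀ {n j} (π : Perm n) → InRange n (suc j) → ∀ {p q} →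
             toℕ p ≡ j → toℕ q ≡ suc j → π ⟨$⟩ʳ q F.< π ⟨$⟩ʳ p →
             suc (inversions (π · gen n (suc j))) ≡ inversions π
inversions-·gen-> {n} {j} π vj p≡j q≡1+j πq<πp = begin
  suc (inversions (π · gen n (suc j)))      ≡⟨ cong suc (inversions-·gen≡inversions-gen·flip π (suc j)) ⟩
  suc (inversions (gen n (suc j) · flip π)) ≡⟨ inversions-gen·-> (flip π) vj (trans (cong toℕ (inverseˡ π)) p≡j)
                                                              (trans (cong toℕ (inverseˡ π)) q≡1+j) πq<πp ⟩
  inversions (flip π)                       ≡⟨ inversions-flip π ⟩
  inversions π                              ∎
  where open ≡-Reasoning

preimage : ∀ {n} (π : Perm n) {y} → y < n → Σ (Fin n) λ x → toℕ (π ⟨$⟩ʳ x) ≡ y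
preimage π y<n = π ⟨$⟩ˡ fromℕ< y<n , trans (cong toℕ (inverseʳ π)) (toℕ-fromℕ< y<n)

inversions-gen·-≤ : ∀ {n i} (π : Perm n) → InRange n i → inversions (gen n i · π) ≤ suc (inversions π)
inversions-gen·-≤ {i = zero} π (() , _)
inversions-gen·-≤ {n} {suc j} π vj@(_ , 1+j<n) with preimage π (<-trans (n<1+n j) 1+j<n) | preimage π 1+j<n
... | p , πp≡j | q , πq≡1+j with FP.<-cmp p q
...   | tri< p<q _ _ = ≤-reflexive (inversions-gen·-< π vj πp≡j πq≡1+j p<q)
...   | tri> _ _ q<p = m≤n⇒m≤1+n (≤-trans (n≤1+n _) (≤-reflexive (inversions-gen·-> π vj πp≡j πq≡1+j q<p)))
...   | tri≈ _ refl _ = contradiction (trans (sym πp≡j) πq≡1+j) (1+n≢n ∘ sym)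

inversions-·gen-≤ : ∀ {n i} (π : Perm n) → InRange n i → inversions (π · gen n i) ≤ suc (inversions π)
inversions-·gen-≤ {n} {i} π vi = begin
  inversions (π · gen n i)        ≡⟨ inversions-·gen≡inversions-gen·flip π i ⟩
  inversions (gen n i · flip π)   ≤⟨ inversions-gen·-≤ (flip π) vi ⟩
  suc (inversions (flip π))       ≡⟨ cong suc (inversions-flip π) ⟩
  suc (inversions π)              ∎
  where open ≤-Reasoning

inversions-≤-length : ∀ {n ws} → ValidWord n ws → inversions (prod n ws) ≤ length ws
inversions-≤-length {n} [] = ≤-reflexive (inversions-id n)
inversions-≤-length {ws = i ∷ ws} (vi ∷ vws) = ≤-trans (inversions-gen·-≤ (prod _ ws) vi) (s≤s (inversions-≤-length vws))

sum-mono-≤ : ∀ {n} {f g : Fin n → ℕ} → (∀ i → f i ≤ g i) → sum f ≤ sum g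
sum-mono-≤ {zero}  f≤g = ≤-refl
sum-mono-≤ {suc n} f≤g = +-mono-≤ (f≤g F.zero) (sum-mono-≤ (f≤g ∘ F.suc))

sum-≡∧≤⇒≡ : ∀ {n} {f g : Fin n → ℕ} → (∀ i → f i ≤ g i) → sum f ≡ sum g → ∀ i → f i ≡ g i
sum-≡∧≤⇒≡ {suc n} {f} {g} f≤g Σf≡Σg = λ where
    F.zero    → f₀≡g₀
    (F.suc i) → sum-≡∧≤⇒≡ (f≤g ∘ F.suc) (+-cancelˡ-≡ (f F.zero) _ _ (trans Σf≡Σg (cong (_+ _) (sym f₀≡g₀)))) i
  where
  open ≤-Reasoning
  f₀≡g₀ : f F.zero ≡ g F.zero
  f₀≡g₀ = ≤-antisym (f≤g F.zero) (+-cancelʳ-≤ (sum (f ∘ F.suc)) _ _ (begin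
    g F.zero + sum (f ∘ F.suc) ≤⟨ +-monoʳ-≤ (g F.zero) (sum-mono-≤ (f≤g ∘ F.suc)) ⟩
    g F.zero + sum (g ∘ F.suc) ≡⟨ Σf≡Σg ⟨
    f F.zero + sum (f ∘ F.suc) ∎))

Descent : ∀ {n} → Perm n → Fin n → Set
Descent {n} π t = Σ (suc (toℕ t) < n) λ 1+t<n → π ⟨$⟩ʳ fromℕ< 1+t<n F.< π ⟨$⟩ʳ t

descent? : ∀ {n} (π : Perm n) t → Dec (Descent π t)
descent? {n} π t with suc (toℕ t) <? n
... | no 1+t≮n = no (1+t≮n ∘ proj₁)
... | yes 1+t<n with π ⟨$⟩ʳ fromℕ< 1+t<n F.<? π ⟨$⟩ʳ t
...   | yes d = yes (1+t<n , d)
...   | no ¬d = no (¬d ∘ proj₂)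

ascending⇒≤ : ∀ {n} (π : Perm n) → (∀ t → ¬ Descent π t) → ∀ x → toℕ x ≤ toℕ (π ⟨$⟩ʳ x)
ascending⇒≤ {n} π ascending x = bound (toℕ x) x refl
  where
  bound : ∀ m x → toℕ x ≡ m → m ≤ toℕ (π ⟨$⟩ʳ x)
  bound zero    x _      = z≤n
  bound (suc m) x x≡1+m  = ≤-<-trans (bound m y y≡m) πy<πx
    where
    1+m<n = subst (_< n) x≡1+m (FP.toℕ<n x)
    y = fromℕ< (<-trans (n<1+n m) 1+m<n)
    y≡m = toℕ-fromℕ< (<-trans (n<1+n m) 1+m<n)
    1+y<n = subst (λ k → suc k < n) (sym y≡m) 1+m<n
    next≡x : fromℕ< 1+y<n ≡ x
    next≡x = toℕ-injective (trans (toℕ-fromℕ< 1+y<n) (trans (cong suc y≡m) (sym x≡1+m)))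
    πy<πx : toℕ (π ⟨$⟩ʳ y) < toℕ (π ⟨$⟩ʳ x)
    πy<πx = subst (λ z → toℕ (π ⟨$⟩ʳ y) < toℕ (π ⟨$⟩ʳ z)) next≡x
      (≤∧≢⇒< (≮⇒≥ (ascending y ∘ (1+y<n ,_)))
             (λ e → <-irrefl (trans (cong toℕ (perm-injective π e)) (toℕ-fromℕ< 1+y<n)) (n<1+n (toℕ y))))

-- Values only move up, yet their total is unchanged.
ascending⇒id : ∀ {n} (π : Perm n) → (∀ t → ¬ Descent π t) → π ≈ₚ idₚ
ascending⇒id π ascending x =
  toℕ-injective (sym (sum-≡∧≤⇒≡ (ascending⇒≤ π ascending) (sum-permute toℕ π) x))

bubble-sort : ∀ {n} k (π : Perm n) → inversions π ≡ k →
              Σ (List ℕ) λ ws → ValidWord n ws × (prod n ws ≈ₚ π) × (length ws ≡ k)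
bubble-sort {n} k π invπ≡k with FP.any? (descent? π)
... | no ¬descent =
  [] , [] , (λ x → sym (π≈id x)) , trans (sym (inversions-id n)) (trans (sym (inversions-cong {π = π} {ρ = idₚ} π≈id)) invπ≡k)
  where
  π≈id : π ≈ₚ idₚ
  π≈id = ascending⇒id π (λ t d → ¬descent (t , d))
... | yes (t , 1+t<n , d) = shorten k invπ≡k
  where
  j = toℕ t
  g = gen n (suc j)
  vj : InRange n (suc j)
  vj = s≤s z≤n , 1+t<n
  step : suc (inversions (π · g)) ≡ inversions π
  step = inversions-·gen-> π vj refl (toℕ-fromℕ< 1+t<n) d
  shorten : ∀ k → inversions π ≡ k → Σ (List ℕ) λ ws → ValidWord n ws × (prod n ws ≈ₚ π) × (length ws ≡ k)
  shorten zero    invπ≡0   = contradiction (trans step invπ≡0) λ ()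
  shorten (suc k) invπ≡1+k with bubble-sort k (π · g) (suc-injective (trans step invπ≡1+k))
  ... | ws , vws , ws≈πg , |ws|≡k =
    ws ++ suc j ∷ [] , ++⁺ vws (vj ∷ []) , ws∷ʳj≈π , trans (length-++ ws) (trans (+-comm (length ws) 1) (cong suc |ws|≡k))
    where
    ws∷ʳj≈π : prod n (ws ++ suc j ∷ []) ≈ₚ π
    ws∷ʳj≈π x = trans (prod-++ n ws (suc j ∷ []) x)
                      (trans (ws≈πg (g ⟨$⟩ʳ x)) (cong (π ⟨$⟩ʳ_) (gen-involutive n (suc j) x)))

record ReducedWord (n : ℕ) (w : Perm n) (ws : List ℕ) : Set where
  constructor reducedWord
  field
    valid             : ValidWord n ws
    prod≈             : prod n ws ≈ₚ w
    length≡inversions : length ws ≡ inversions w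

reduced⇒length≡inversions : ∀ {n} {w : Perm n} {ws} → IsReducedExpr w ws → length ws ≡ inversions w
reduced⇒length≡inversions {n} {w} {ws} (vws , ws≈w , minimal) with bubble-sort (inversions w) w refl
... | vs , vvs , vs≈w , |vs|≡inv =
  ≤-antisym (≤-trans (minimal vs vvs vs≈w) (≤-reflexive |vs|≡inv))
            (≤-trans (≤-reflexive (inversions-cong {π = w} {prod n ws} (λ x → sym (ws≈w x)))) (inversions-≤-length vws))

reducedWord⇒reduced : ∀ {n} {w : Perm n} {ws} → ReducedWord n w ws → IsReducedExpr w ws
reducedWord⇒reduced {n} {w} (reducedWord vws ws≈w |ws|≡inv) = vws , ws≈w , λ vs vvs vs≈w →
  ≤-trans (≤-reflexive |ws|≡inv)
          (≤-trans (≤-reflexive (inversions-cong {π = w} {prod n vs} (λ x → sym (vs≈w x)))) (inversions-≤-length vvs))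

gen·-ascent : ∀ {n j} (π : Perm n) → InRange n (suc j) → ∀ {p q} →
              toℕ (π ⟨$⟩ʳ p) ≡ j → toℕ (π ⟨$⟩ʳ q) ≡ suc j → inversions π < inversions (gen n (suc j) · π) → p F.< q
gen·-ascent π vj {p} {q} πp≡j πq≡1+j inv< with FP.<-cmp p q
... | tri< p<q _ _ = p<q
... | tri≈ _ refl _ = contradiction (trans (sym πp≡j) πq≡1+j) (1+n≢n ∘ sym)
... | tri> _ _ q<p =
  contradiction (subst (inversions (gen _ (suc _) · π) <_) (inversions-gen·-> π vj πp≡j πq≡1+j q<p) (n<1+n _)) (<-asym inv<)

·gen-ascent : ∀ {n j} (π : Perm n) → InRange n (suc j) → ∀ {p q} →
              toℕ p ≡ j → toℕ q ≡ suc j → inversions π < inversions (π · gen n (suc j)) → π ⟨$⟩ʳ p F.< π ⟨$⟩ʳ q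
·gen-ascent π vj {p} {q} p≡j q≡1+j inv< with FP.<-cmp (π ⟨$⟩ʳ p) (π ⟨$⟩ʳ q)
... | tri< πp<πq _ _ = πp<πq
... | tri≈ _ πp≡πq _ =
  contradiction (trans (sym p≡j) (trans (cong toℕ (perm-injective π (cong toℕ πp≡πq))) q≡1+j)) (1+n≢n ∘ sym)
... | tri> _ _ πq<πp =
  contradiction (subst (inversions (π · gen _ (suc _)) <_) (inversions-·gen-> π vj p≡j q≡1+j πq<πp) (n<1+n _)) (<-asym inv<)

-- Moving a convex subheap to the middle of a word

module _ {A : Set} where

  -- The choice is an argument of select-cons and selected-cons so that `with keep zero` abstracts it.
  select-cons : Bool → A → List A → List A
  select-cons true  x ys = x ∷ ys
  select-cons false x ys = ys

  select : (xs : List A) → (Fin (length xs) → Bool) → List A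
  select []       keep = []
  select (x ∷ xs) keep = select-cons (keep F.zero) x (select xs (keep ∘ F.suc))

  selected-cons : ∀ b x ys {m} → (Fin (length ys) → Fin m) → Fin (length (select-cons b x ys)) → Fin (suc m)
  selected-cons true  x ys σ F.zero    = F.zero
  selected-cons true  x ys σ (F.suc i) = F.suc (σ i)
  selected-cons false x ys σ i         = F.suc (σ i)

  selected : ∀ (xs : List A) (keep : Fin (length xs) → Bool) → Fin (length (select xs keep)) → Fin (length xs)
  selected (x ∷ xs) keep = selected-cons (keep F.zero) x _ (selected xs (keep ∘ F.suc))

  lookup-selected : ∀ (xs : List A) (keep : Fin (length xs) → Bool) i → lookup xs (selected xs keep i) ≡ lookup (select xs keep) i
  lookup-selected (x ∷ xs) keep i with keep F.zero | i
  ... | true  | F.zero  = refl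
  ... | true  | F.suc i = lookup-selected xs (keep ∘ F.suc) i
  ... | false | i       = lookup-selected xs (keep ∘ F.suc) i

  selected-kept : ∀ (xs : List A) (keep : Fin (length xs) → Bool) i → keep (selected xs keep i) ≡ true
  selected-kept (x ∷ xs) keep i with keep F.zero in kept | i
  ... | true  | F.zero  = kept
  ... | true  | F.suc i = selected-kept xs (keep ∘ F.suc) i
  ... | false | i       = selected-kept xs (keep ∘ F.suc) i

  selected-mono : ∀ (xs : List A) (keep : Fin (length xs) → Bool) {i j} → i F.< j → selected xs keep i F.< selected xs keep j
  selected-mono (x ∷ xs) keep {i} {j} i<j with keep F.zero | i | j | i<j
  ... | true  | F.zero  | F.suc j | _       = s≤s z≤n
  ... | true  | F.suc i | F.suc j | s≤s i<j = s≤s (selected-mono xs (keep ∘ F.suc) i<j)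
  ... | false | i       | j       | i<j     = s≤s (selected-mono xs (keep ∘ F.suc) i<j)

  selected-surjective : ∀ (xs : List A) (keep : Fin (length xs) → Bool) k → keep k ≡ true →
                        Σ (Fin (length (select xs keep))) λ i → selected xs keep i ≡ k
  selected-surjective (x ∷ xs) keep k kept with keep F.zero in kept₀ | k
  ... | true  | F.zero  = F.zero , refl
  ... | false | F.zero  = contradiction (trans (sym kept₀) kept) λ ()
  ... | true  | F.suc k = let i , e = selected-surjective xs (keep ∘ F.suc) k kept in F.suc i , cong F.suc e
  ... | false | F.suc k = let i , e = selected-surjective xs (keep ∘ F.suc) k kept in i , cong F.suc e

  select-All : ∀ {P : A → Set} (xs : List A) (keep : Fin (length xs) → Bool) →
               (∀ k → keep k ≡ true → P (lookup xs k)) → All P (select xs keep)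
  select-All []       keep Pkept = []
  select-All (x ∷ xs) keep Pkept with keep F.zero in kept₀
  ... | true  = Pkept F.zero kept₀ ∷ select-All xs (keep ∘ F.suc) (Pkept ∘ F.suc)
  ... | false = select-All xs (keep ∘ F.suc) (Pkept ∘ F.suc)

data Region : Set where
  below inside rest : Region

_==_ : Region → Region → Bool
below  == below  = true
inside == inside = true
rest   == rest   = true
_      == _      = false

==⇒≡ : ∀ r s → (r == s) ≡ true → r ≡ s
==⇒≡ below  below  _ = refl
==⇒≡ inside inside _ = refl
==⇒≡ rest   rest   _ = refl
==⇒≡ below  inside ()
==⇒≡ below  rest   ()
==⇒≡ inside below  ()
==⇒≡ inside rest   ()
==⇒≡ rest   below  ()
==⇒≡ rest   inside ()

≡⇒== : ∀ {r s} → r ≡ s → (r == s) ≡ true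
≡⇒== {below}  refl = refl
≡⇒== {inside} refl = refl
≡⇒== {rest}   refl = refl

rank : Region → ℕ
rank below  = 0
rank inside = 1
rank rest   = 2

part : (ws : List ℕ) → (Fin (length ws) → Region) → Region → List ℕ
part ws region r = select ws (λ k → region k == r)

regroup : (ws : List ℕ) → (Fin (length ws) → Region) → List ℕ
regroup ws region = part ws region below ++ part ws region inside ++ part ws region rest

regroup-↭ : ∀ ws region → regroup ws region ↭ ws
regroup-↭ []       region = ↭-refl
regroup-↭ (x ∷ xs) region with region F.zero
... | below  = ↭-prep x (regroup-↭ xs (region ∘ F.suc))
... | inside = ↭-trans (↭.shift x L (M ++ R)) (↭-prep x (regroup-↭ xs (region ∘ F.suc)))
  where
  L = part xs (region ∘ F.suc) below
  M = part xs (region ∘ F.suc) inside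
  R = part xs (region ∘ F.suc) rest
... | rest   = ↭-trans (↭-reflexive (sym (++-assoc L M (x ∷ R))))
              (↭-trans (↭.shift x (L ++ M) R)
              (↭-prep x (↭-trans (↭-reflexive (++-assoc L M R)) (regroup-↭ xs (region ∘ F.suc)))))
  where
  L = part xs (region ∘ F.suc) below
  M = part xs (region ∘ F.suc) inside
  R = part xs (region ∘ F.suc) rest

prod-commute-past : ∀ n x ys zs → All (Commute n x) ys → prod n (ys ++ x ∷ zs) ≈ₚ prod n (x ∷ ys ++ zs)
prod-commute-past n x []       zs []                t = refl
prod-commute-past n x (y ∷ ys) zs (x∘y≈y∘x ∷ commute) t =
  trans (cong (gen n y ⟨$⟩ʳ_) (prod-commute-past n x ys zs commute t)) (sym (x∘y≈y∘x (prod n (ys ++ zs) ⟨$⟩ʳ t)))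

InversionsCommute : ℕ → (ws : List ℕ) → (Fin (length ws) → Region) → Set
InversionsCommute n ws region = ∀ i j → i F.< j → rank (region j) < rank (region i) →
                                Commute n (lookup ws i) (lookup ws j)

module _ {n x xs} {region : Fin (length (x ∷ xs)) → Region} (commute : InversionsCommute n (x ∷ xs) region) where

  tail-commute : InversionsCommute n xs (region ∘ F.suc)
  tail-commute i j i<j = commute (F.suc i) (F.suc j) (s≤s i<j)

  head-commutes : ∀ {r s} → region F.zero ≡ s → rank r < rank s → All (Commute n x) (part xs (region ∘ F.suc) r)
  head-commutes {r} region₀ r<s = select-All xs _ λ k in-r → commute F.zero (F.suc k) (s≤s z≤n)
    (subst₂ (λ a b → rank a < rank b) (sym (==⇒≡ _ r in-r)) (sym region₀) r<s)

regroup-prod : ∀ n ws region → InversionsCommute n ws region → prod n (regroup ws region) ≈ₚ prod n ws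
regroup-prod n []       region commute t = refl
regroup-prod n (x ∷ xs) region commute t with region F.zero in region₀
... | below  = cong (gen n x ⟨$⟩ʳ_) (IH t)
  where IH = regroup-prod n xs (region ∘ F.suc) (tail-commute commute)
... | inside = begin
  prod n (L ++ x ∷ M ++ R) ⟨$⟩ʳ t   ≡⟨ prod-commute-past n x L (M ++ R) (head-commutes commute region₀ (s≤s z≤n)) t ⟩
  gen n x ⟨$⟩ʳ (prod n (L ++ M ++ R) ⟨$⟩ʳ t) ≡⟨ cong (gen n x ⟨$⟩ʳ_) (IH t) ⟩
  gen n x ⟨$⟩ʳ (prod n xs ⟨$⟩ʳ t)   ∎
  where
  open ≡-Reasoning
  IH = regroup-prod n xs (region ∘ F.suc) (tail-commute commute)
  L = part xs (region ∘ F.suc) below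
  M = part xs (region ∘ F.suc) inside
  R = part xs (region ∘ F.suc) rest
... | rest   = begin
  prod n (L ++ M ++ x ∷ R) ⟨$⟩ʳ t   ≡⟨ cong (λ l → prod n l ⟨$⟩ʳ t) (++-assoc L M (x ∷ R)) ⟨
  prod n ((L ++ M) ++ x ∷ R) ⟨$⟩ʳ t ≡⟨ prod-commute-past n x (L ++ M) R LM-commute t ⟩
  gen n x ⟨$⟩ʳ (prod n ((L ++ M) ++ R) ⟨$⟩ʳ t) ≡⟨ cong (λ l → gen n x ⟨$⟩ʳ (prod n l ⟨$⟩ʳ t)) (++-assoc L M R) ⟩
  gen n x ⟨$⟩ʳ (prod n (L ++ M ++ R) ⟨$⟩ʳ t)   ≡⟨ cong (gen n x ⟨$⟩ʳ_) (IH t) ⟩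
  gen n x ⟨$⟩ʳ (prod n xs ⟨$⟩ʳ t)   ∎
  where
  open ≡-Reasoning
  IH = regroup-prod n xs (region ∘ F.suc) (tail-commute commute)
  L = part xs (region ∘ F.suc) below
  M = part xs (region ∘ F.suc) inside
  R = part xs (region ∘ F.suc) rest
  LM-commute = ++⁺ (head-commutes commute region₀ (s≤s z≤n)) (head-commutes commute region₀ (s≤s (s≤s z≤n)))

Increasing : ∀ {m k} → (Fin m → Fin k) → Set
Increasing f = ∀ {a b} → a F.< b → f a F.< f b

increasing⇒injective : ∀ {m k} {f : Fin m → Fin k} → Increasing f → ∀ {a b} → f a ≡ f b → a ≡ b
increasing⇒injective f↑ {a} {b} fa≡fb with FP.<-cmp a b
... | tri< a<b _ _ = contradiction fa≡fb (FP.<⇒≢ (f↑ a<b))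
... | tri≈ _ a≡b _ = a≡b
... | tri> _ _ b<a = contradiction (sym fa≡fb) (FP.<⇒≢ (f↑ b<a))

increasing-reflects-< : ∀ {m k} {f : Fin m → Fin k} → Increasing f → ∀ {a b} → f a F.< f b → a F.< b
increasing-reflects-< f↑ {a} {b} fa<fb with FP.<-cmp a b
... | tri< a<b _ _ = a<b
... | tri≈ _ refl _ = contradiction fa<fb (FP.<-irrefl refl)
... | tri> _ _ b<a = contradiction fa<fb (FP.<-asym (f↑ b<a))

module _ {A B : Set} {RA : A → A → Set} {RB : B → B → Set} (σ : A → B)
         (σ-injective : ∀ {a b} → σ a ≡ σ b → a ≡ b) (reflect : ∀ {a b} → RB (σ a) (σ b) → RA a b)
         (closed : ∀ a y b → RB (σ a) y → Star RB y (σ b) → Σ A λ a′ → σ a′ ≡ y) where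

  star-reflect : ∀ {s t} → Star RB s t → ∀ {a b} → s ≡ σ a → t ≡ σ b → Star RA a b
  star-reflect ε {a} {b} refl σa≡σb = subst (Star RA a) (σ-injective {a} {b} σa≡σb) ε
  star-reflect (_◅_ {j = y} s⋖y y≤t) {a} {b} refl refl with closed a y b s⋖y y≤t
  ... | a′ , refl = reflect s⋖y ◅ star-reflect y≤t refl refl

heapLe-position : ∀ {n ws i j} → HeapLe n ws i j → toℕ i ≤ toℕ j
heapLe-position                   ε                 = ≤-refl
heapLe-position {n} {ws} ((i<k , _) ◅ k≤j) = ≤-trans (<⇒≤ i<k) (heapLe-position {n} {ws} k≤j)

data Low : Region → Set where
  below  : Low below
  inside : Low inside

low? : ∀ r → Dec (Low r)
low? below  = yes below
low? inside = yes inside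
low? rest   = no λ ()

head-region : ∀ {A : Set} → Bool → Dec A → Region
head-region true  _       = inside
head-region false (yes _) = below
head-region false (no _)  = rest

low-neighbour? : ∀ x xs (region : Fin (length xs) → Region) →
                 Dec (Σ (Fin (length xs)) λ t → Low (region t) × Adjacent x (lookup xs t))
low-neighbour? x xs region = FP.any? λ t → low? (region t) ×-dec adjacent? x (lookup xs t)

-- A position lies inside the convex set C, below it (it precedes, through a chain of non-commuting
-- letters, a position of C), or neither.
classify : (ws : List ℕ) → (Fin (length ws) → Bool) → Fin (length ws) → Region
classify (x ∷ xs) inC F.zero    = head-region (inC F.zero) (low-neighbour? x xs (classify xs (inC ∘ F.suc)))
classify (x ∷ xs) inC (F.suc k) = classify xs (inC ∘ F.suc) k

classify-inside : ∀ ws inC k → classify ws inC k ≡ inside → inC k ≡ true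
classify-inside (x ∷ xs) inC F.zero    region≡inside with inC F.zero | low-neighbour? x xs (classify xs (inC ∘ F.suc))
classify-inside (x ∷ xs) inC F.zero    refl | true  | _ = refl
classify-inside (x ∷ xs) inC F.zero    ()   | false | yes _
classify-inside (x ∷ xs) inC F.zero    ()   | false | no _
classify-inside (x ∷ xs) inC (F.suc k) region≡inside = classify-inside xs (inC ∘ F.suc) k region≡inside

inside-classify : ∀ ws inC k → inC k ≡ true → classify ws inC k ≡ inside
inside-classify (x ∷ xs) inC F.zero    inCk with inC F.zero
... | true = refl
inside-classify (x ∷ xs) inC (F.suc k) inCk = inside-classify xs (inC ∘ F.suc) k inCk

classify-below : ∀ ws inC k → classify ws inC k ≡ below →
  Σ (Fin (length ws)) λ t → k F.< t × Low (classify ws inC t) × Adjacent (lookup ws k) (lookup ws t)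
classify-below (x ∷ xs) inC F.zero region≡below with inC F.zero | low-neighbour? x xs (classify xs (inC ∘ F.suc))
classify-below (x ∷ xs) inC F.zero refl | false | yes (t , low , adj) = F.suc t , s≤s z≤n , low , adj
classify-below (x ∷ xs) inC (F.suc k) region≡below =
  let t , k<t , low , adj = classify-below xs (inC ∘ F.suc) k region≡below in F.suc t , s≤s k<t , low , adj

classify-rest : ∀ ws inC k → classify ws inC k ≡ rest →
  ∀ t → k F.< t → Low (classify ws inC t) → ¬ Adjacent (lookup ws k) (lookup ws t)
classify-rest (x ∷ xs) inC F.zero region≡rest (F.suc t) _ low adj with inC F.zero | low-neighbour? x xs (classify xs (inC ∘ F.suc))
classify-rest (x ∷ xs) inC F.zero refl (F.suc t) _ low adj | false | no ¬below = ¬below (t , low , adj)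
classify-rest (x ∷ xs) inC (F.suc k) region≡rest (F.suc t) (s≤s k<t) low adj =
  classify-rest xs (inC ∘ F.suc) k region≡rest t k<t low adj

module ConvexRegions {n ws} (vws : ValidWord n ws) {p} (φ : Fin p → Fin (length ws))
  (convex : ∀ a b x → HeapLe n ws (φ a) x → HeapLe n ws x (φ b) → Σ (Fin p) λ c → φ c ≡ x) where

  inC : Fin (length ws) → Bool
  inC k = does (FP.any? λ a → φ a F.≟ k)

  inC⇒image : ∀ k → inC k ≡ true → Σ (Fin p) λ a → φ a ≡ k
  inC⇒image k _ with FP.any? (λ a → φ a F.≟ k)
  ... | yes image = image

  image⇒inC : ∀ a → inC (φ a) ≡ true
  image⇒inC a with FP.any? (λ b → φ b F.≟ φ a)
  ... | yes _ = refl
  ... | no ∉  = contradiction (a , refl) ∉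

  region : Fin (length ws) → Region
  region = classify ws inC

  inside⇒image : ∀ k → region k ≡ inside → Σ (Fin p) λ a → φ a ≡ k
  inside⇒image k = inC⇒image k ∘ classify-inside ws inC k

  between⇒inside : ∀ a b x → HeapLe n ws (φ a) x → HeapLe n ws x (φ b) → region x ≡ inside
  between⇒inside a b x φa≤x x≤φb =
    let c , φc≡x = convex a b x φa≤x x≤φb in inside-classify ws inC x (subst (λ y → inC y ≡ true) φc≡x (image⇒inC c))

  letter-range : ∀ k → InRange n (lookup ws k)
  letter-range k = All.lookup vws (∈-lookup k)

  cover : ∀ {i j} → i F.< j → Adjacent (lookup ws i) (lookup ws j) → HeapCover n ws i j
  cover i<j adj = i<j , adjacent⇒¬commute (letter-range _) (letter-range _) adj

  -- d is fuel: the witnesses of Low move strictly to the right.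
  low-reaches : ∀ d k → length ws ≤ toℕ k + d → Low (region k) → Σ (Fin p) λ a → HeapLe n ws k (φ a)
  low-reaches d k bound low with region k in region≡ | low
  ... | inside | _ = let a , φa≡k = inside⇒image k region≡ in a , subst (HeapLe n ws k) (sym φa≡k) ε
  ... | below  | _ with classify-below ws inC k region≡ | d
  ...   | t , k<t , low , adj | zero  = contradiction (subst (length ws ≤_) (+-identityʳ _) bound) (<⇒≱ (FP.toℕ<n k))
  ...   | t , k<t , low , adj | suc d =
    let a , t≤φa = low-reaches d t (≤-trans bound (≤-trans (≤-reflexive (+-suc _ d)) (+-monoˡ-≤ d k<t))) low
    in a , cover k<t adj ◅ t≤φa

  low⇒reaches-C : ∀ k → Low (region k) → Σ (Fin p) λ a → HeapLe n ws k (φ a)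
  low⇒reaches-C k = low-reaches (length ws) k (m≤n+m _ _)

  -- An inside letter followed by an adjacent letter below C would, by convexity, force the latter into C.
  inversions-commute : InversionsCommute n ws region
  inversions-commute i j i<j rank< with region i in region-i | region j in region-j
  ... | rest   | below  = ¬adjacent⇒commute (letter-range i) (letter-range j)
                            (classify-rest ws inC i region-i j i<j (subst Low (sym region-j) below))
  ... | rest   | inside = ¬adjacent⇒commute (letter-range i) (letter-range j)
                            (classify-rest ws inC i region-i j i<j (subst Low (sym region-j) inside))
  ... | inside | below with adjacent? (lookup ws i) (lookup ws j)
  ...   | no ¬adj = ¬adjacent⇒commute (letter-range i) (letter-range j) ¬adj
  ...   | yes adj =
    let a , φa≡i = inside⇒image i region-i
        b , j≤φb = low⇒reaches-C j (subst Low (sym region-j) below)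
        i≤j = subst (λ x → HeapLe n ws x j) (sym φa≡i) (cover i<j adj ◅ ε)
    in contradiction (trans (sym region-j) (between⇒inside a b j i≤j j≤φb)) λ ()
  inversions-commute i j i<j () | below  | _
  inversions-commute i j i<j (s≤s ()) | inside | inside
  inversions-commute i j i<j (s≤s ()) | inside | rest
  inversions-commute i j i<j (s≤s (s≤s ())) | rest | rest

  Cs : List ℕ
  Cs = part ws region inside

  ρ : Fin (length Cs) → Fin (length ws)
  ρ = selected ws (λ k → region k == inside)

  ρ-injective : ∀ {i j} → ρ i ≡ ρ j → i ≡ j
  ρ-injective = increasing⇒injective (selected-mono ws _)

  ρ-image : ∀ i → Σ (Fin p) λ a → φ a ≡ ρ i
  ρ-image i = inside⇒image (ρ i) (==⇒≡ _ inside (selected-kept ws _ i))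

  inside⇒ρ-image : ∀ k → region k ≡ inside → Σ (Fin (length Cs)) λ i → ρ i ≡ k
  inside⇒ρ-image k region≡ = selected-surjective ws _ k (≡⇒== region≡)

  image⇒ρ-image : ∀ a → Σ (Fin (length Cs)) λ i → ρ i ≡ φ a
  image⇒ρ-image a = inside⇒ρ-image (φ a) (inside-classify ws inC (φ a) (image⇒inC a))

  ρ-cover : ∀ {i j} → HeapCover n Cs i j ⇔ HeapCover n ws (ρ i) (ρ j)
  ρ-cover {i} {j} = mk⇔
    (λ (i<j , ¬commute) → selected-mono ws _ i<j ,
       subst₂ (λ x y → ¬ Commute n x y) (sym (lookup-selected ws _ i)) (sym (lookup-selected ws _ j)) ¬commute)
    (λ (ρi<ρj , ¬commute) → increasing-reflects-< (selected-mono ws _) ρi<ρj ,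
       subst₂ (λ x y → ¬ Commute n x y) (lookup-selected ws _ i) (lookup-selected ws _ j) ¬commute)

  ρ-heapLe : ∀ {i j} → HeapLe n Cs i j → HeapLe n ws (ρ i) (ρ j)
  ρ-heapLe = gmap ρ (Equivalence.to ρ-cover)

  heapLe-ρ : ∀ {i j} → HeapLe n ws (ρ i) (ρ j) → HeapLe n Cs i j
  heapLe-ρ ρi≤ρj = star-reflect ρ ρ-injective (Equivalence.from ρ-cover) between ρi≤ρj refl refl
    where
    between : ∀ i y j → HeapCover n ws (ρ i) y → HeapLe n ws y (ρ j) → Σ (Fin (length Cs)) λ i′ → ρ i′ ≡ y
    between i y j ρi⋖y y≤ρj =
      let a , φa≡ρi = ρ-image i
          b , φb≡ρj = ρ-image j
      in inside⇒ρ-image y (between⇒inside a b y (subst (λ x → HeapLe n ws x y) (sym φa≡ρi) (ρi⋖y ◅ ε))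
                                                 (subst (HeapLe n ws y) (sym φb≡ρj) y≤ρj))

-- Convex embeddings of heaps

record ConvexEmbedding (k k′ : ℕ) (g : ℕ → ℕ) (xs ys : List ℕ) : Set where
  constructor convexEmbedding
  field
    σ         : Fin (length xs) → Fin (length ys)
    injective : ∀ a b → σ a ≡ σ b → a ≡ b
    label     : ∀ a → lookup ys (σ a) ≡ g (lookup xs a)
    order     : ∀ a b → (HeapLe k xs a b → HeapLe k′ ys (σ a) (σ b)) × (HeapLe k′ ys (σ a) (σ b) → HeapLe k xs a b)
    convex    : ∀ a b y → HeapLe k′ ys (σ a) y → HeapLe k′ ys y (σ b) → Σ (Fin (length xs)) λ c → σ c ≡ y

convexEmbedding⇒subheap : ∀ {k xs ys} → ConvexEmbedding k k id xs ys → ConvexLabeledSubheap k xs ys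
convexEmbedding⇒subheap (convexEmbedding σ injective label order convex) = σ , injective , label , order , convex

subheap⇒convexEmbedding : ∀ {k xs ys} → ConvexLabeledSubheap k xs ys → ConvexEmbedding k k id xs ys
subheap⇒convexEmbedding (σ , injective , label , order , convex) = convexEmbedding σ injective label order convex

convexEmbedding-∘ : ∀ {k₁ k₂ k₃ g₁ g₂ xs ys zs} → ConvexEmbedding k₁ k₂ g₁ xs ys → ConvexEmbedding k₂ k₃ g₂ ys zs →
                    ConvexEmbedding k₁ k₃ (g₂ ∘ g₁) xs zs
convexEmbedding-∘ {k₃ = k₃} {g₂ = g₂} {xs} {zs = zs}
  (convexEmbedding σ₁ σ₁-injective lab₁ ord₁ conv₁) (convexEmbedding σ₂ σ₂-injective lab₂ ord₂ conv₂) =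
  convexEmbedding (σ₂ ∘ σ₁)
    (λ a b → σ₁-injective a b ∘ σ₂-injective _ _)
    (λ a → trans (lab₂ (σ₁ a)) (cong g₂ (lab₁ a)))
    (λ a b → proj₁ (ord₂ _ _) ∘ proj₁ (ord₁ a b) , proj₂ (ord₁ a b) ∘ proj₂ (ord₂ _ _))
    convex
  where
  convex : ∀ a b z → HeapLe k₃ zs (σ₂ (σ₁ a)) z → HeapLe k₃ zs z (σ₂ (σ₁ b)) → Σ (Fin (length xs)) λ c → σ₂ (σ₁ c) ≡ z
  convex a b z σa≤z z≤σb with conv₂ (σ₁ a) (σ₁ b) z σa≤z z≤σb
  ... | y , refl = let c , σ₁c≡y = conv₁ a b y (proj₂ (ord₂ _ _) σa≤z) (proj₂ (ord₂ _ _) z≤σb) in c , cong σ₂ σ₁c≡y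

convexEmbedding-relabel : ∀ {k k′ g h xs ys} → ConvexEmbedding k k′ g xs ys →
                          (∀ a → g (lookup xs a) ≡ h (lookup xs a)) → ConvexEmbedding k k′ h xs ys
convexEmbedding-relabel (convexEmbedding σ inj lab ord conv) g≡h = convexEmbedding σ inj (λ a → trans (lab a) (g≡h a)) ord conv

-- Heap order refines position order, so a map onto an interval of positions is convex.
increasing⇒convexEmbedding : ∀ {k k′ g xs ys} (σ : Fin (length xs) → Fin (length ys)) → Increasing σ →
  (∀ a → lookup ys (σ a) ≡ g (lookup xs a)) →
  (∀ a b → Commute k (lookup xs a) (lookup xs b) ⇔ Commute k′ (g (lookup xs a)) (g (lookup xs b))) →
  (∀ a b y → toℕ (σ a) ≤ toℕ y → toℕ y ≤ toℕ (σ b) → Σ (Fin (length xs)) λ c → σ c ≡ y) →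
  ConvexEmbedding k k′ g xs ys
increasing⇒convexEmbedding {k} {k′} {g} {xs} {ys} σ σ↑ lab commute⇔ interval =
  convexEmbedding σ (λ a b → increasing⇒injective σ↑) lab (λ a b → gmap σ cover⁺ , reflect)
    (λ a b y σa≤y y≤σb → interval a b y (heapLe-position {k′} {ys} σa≤y) (heapLe-position {k′} {ys} y≤σb))
  where
  cover⁺ : ∀ {a b} → HeapCover k xs a b → HeapCover k′ ys (σ a) (σ b)
  cover⁺ {a} {b} (a<b , ¬commute) = σ↑ a<b ,
    subst₂ (λ x y → ¬ Commute k′ x y) (sym (lab a)) (sym (lab b)) (¬commute ∘ Equivalence.from (commute⇔ a b))
  cover⁻ : ∀ {a b} → HeapCover k′ ys (σ a) (σ b) → HeapCover k xs a b
  cover⁻ {a} {b} (σa<σb , ¬commute) = increasing-reflects-< σ↑ σa<σb ,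
    ¬commute ∘ subst₂ (Commute k′) (sym (lab a)) (sym (lab b)) ∘ Equivalence.to (commute⇔ a b)
  reflect : ∀ {a b} → HeapLe k′ ys (σ a) (σ b) → HeapLe k xs a b
  reflect σa≤σb = star-reflect σ (increasing⇒injective σ↑) cover⁻
    (λ a y b σa⋖y y≤σb → interval a b y (<⇒≤ (proj₁ σa⋖y)) (heapLe-position {k′} {ys} y≤σb)) σa≤σb refl refl

∷-convexEmbedding : ∀ {k} x xs → ConvexEmbedding k k id xs (x ∷ xs)
∷-convexEmbedding x xs = increasing⇒convexEmbedding F.suc s≤s (λ _ → refl) (λ _ _ → mk⇔ id id) interval
  where
  interval : ∀ a b y → toℕ (F.suc a) ≤ toℕ y → toℕ y ≤ toℕ (F.suc b) → Σ (Fin (length xs)) λ c → F.suc c ≡ y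
  interval a b (F.suc y) _ _ = y , refl

inject-++ : ∀ {A : Set} (xs ys : List A) → Fin (length xs) → Fin (length (xs ++ ys))
inject-++ (x ∷ xs) ys F.zero    = F.zero
inject-++ (x ∷ xs) ys (F.suc a) = F.suc (inject-++ xs ys a)

toℕ-inject-++ : ∀ {A : Set} (xs ys : List A) a → toℕ (inject-++ xs ys a) ≡ toℕ a
toℕ-inject-++ (x ∷ xs) ys F.zero    = refl
toℕ-inject-++ (x ∷ xs) ys (F.suc a) = cong suc (toℕ-inject-++ xs ys a)

lookup-inject-++ : ∀ {A : Set} (xs ys : List A) a → lookup (xs ++ ys) (inject-++ xs ys a) ≡ lookup xs a
lookup-inject-++ (x ∷ xs) ys F.zero    = refl
lookup-inject-++ (x ∷ xs) ys (F.suc a) = lookup-inject-++ xs ys a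

inject-++-prefix : ∀ {A : Set} (xs ys : List A) y → toℕ y < length xs → Σ (Fin (length xs)) λ a → inject-++ xs ys a ≡ y
inject-++-prefix (x ∷ xs) ys F.zero    _         = F.zero , refl
inject-++-prefix (x ∷ xs) ys (F.suc y) (s≤s y<∣xs∣) =
  let a , a↦y = inject-++-prefix xs ys y y<∣xs∣ in F.suc a , cong F.suc a↦y

++-convexEmbedding : ∀ {k} xs ys → ConvexEmbedding k k id xs (xs ++ ys)
++-convexEmbedding xs ys =
  increasing⇒convexEmbedding (inject-++ xs ys) increasing (lookup-inject-++ xs ys) (λ _ _ → mk⇔ id id) interval
  where
  increasing : Increasing (inject-++ xs ys)
  increasing {a} {b} = subst₂ _<_ (sym (toℕ-inject-++ xs ys a)) (sym (toℕ-inject-++ xs ys b))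
  interval : ∀ a b y → _ → toℕ y ≤ toℕ (inject-++ xs ys b) → Σ (Fin (length xs)) λ c → inject-++ xs ys c ≡ y
  interval a b y _ y≤b = inject-++-prefix xs ys y (≤-<-trans y≤b (subst (_< length xs) (sym (toℕ-inject-++ xs ys b)) (FP.toℕ<n b)))

++ʳ-convexEmbedding : ∀ {k} xs ys → ConvexEmbedding k k id ys (xs ++ ys)
++ʳ-convexEmbedding []       ys = increasing⇒convexEmbedding id id (λ _ → refl) (λ _ _ → mk⇔ id id) (λ _ _ y _ _ → y , refl)
++ʳ-convexEmbedding (x ∷ xs) ys = convexEmbedding-∘ (++ʳ-convexEmbedding xs ys) (∷-convexEmbedding x (xs ++ ys))

map-convexEmbedding : ∀ {k k′} g xs →
  (∀ a b → Commute k (lookup xs a) (lookup xs b) ⇔ Commute k′ (g (lookup xs a)) (g (lookup xs b))) →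
  ConvexEmbedding k k′ g xs (map g xs)
map-convexEmbedding g xs commute⇔ =
  increasing⇒convexEmbedding σ increasing (lookup-map xs) commute⇔
    λ _ _ y _ _ → F.cast (length-map g xs) y , cast-involutive (sym (length-map g xs)) (length-map g xs) y
  where
  σ = F.cast (sym (length-map g xs))
  increasing : Increasing σ
  increasing {a} {b} = subst₂ _<_ (sym (toℕ-cast _ a)) (sym (toℕ-cast _ b))
  lookup-map : ∀ xs a → lookup (map g xs) (F.cast (sym (length-map g xs)) a) ≡ g (lookup xs a)
  lookup-map (x ∷ xs) F.zero    = refl
  lookup-map (x ∷ xs) (F.suc a) = lookup-map xs a

-- Pattern occurrences under multiplication by a generator

-- Contains w u unfolds to: some ι is increasing and PatternAt w u ι.
PatternAt : ∀ {n r} → Perm n → Perm r → (Fin r → Fin n) → Set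
PatternAt w u ι = ∀ a b → a F.< b →
  ((w ⟨$⟩ʳ ι a) F.< (w ⟨$⟩ʳ ι b) → (u ⟨$⟩ʳ a) F.< (u ⟨$⟩ʳ b)) ×
  ((u ⟨$⟩ʳ a) F.< (u ⟨$⟩ʳ b) → (w ⟨$⟩ʳ ι a) F.< (w ⟨$⟩ʳ ι b))

contains-trans : ∀ {n r k} {w : Perm n} {u : Perm r} {p : Perm k} → Contains w u → Contains u p → Contains w p
contains-trans (ι , ι↑ , w∼u) (κ , κ↑ , u∼p) =
  ι ∘ κ , (λ a b a<b → ι↑ _ _ (κ↑ a b a<b)) ,
  λ a b a<b → proj₁ (u∼p a b a<b) ∘ proj₁ (w∼u _ _ (κ↑ a b a<b)) , proj₂ (w∼u _ _ (κ↑ a b a<b)) ∘ proj₂ (u∼p a b a<b)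

contains-respˡ-≈ : ∀ {n r} {w w₁ : Perm n} {u : Perm r} → w ≈ₚ w₁ → Contains w u → Contains w₁ u
contains-respˡ-≈ w≈w₁ (ι , ι↑ , w∼u) = ι , ι↑ , λ a b a<b →
  subst₂ (λ x y → (x F.< y → _) × (_ → x F.< y)) (w≈w₁ (ι a)) (w≈w₁ (ι b)) (w∼u a b a<b)

pattern-≢ : ∀ {n r} {w : Perm n} {u : Perm r} {ι} → Increasing ι → PatternAt w u ι → ∀ {a b} → a ≢ b →
  ((w ⟨$⟩ʳ ι a) F.< (w ⟨$⟩ʳ ι b) → (u ⟨$⟩ʳ a) F.< (u ⟨$⟩ʳ b)) ×
  ((u ⟨$⟩ʳ a) F.< (u ⟨$⟩ʳ b) → (w ⟨$⟩ʳ ι a) F.< (w ⟨$⟩ʳ ι b))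
pattern-≢ {w = w} {u} {ι} ι↑ w∼u {a} {b} a≢b with FP.<-cmp a b
... | tri< a<b _ _ = w∼u a b a<b
... | tri≈ _ a≡b _ = contradiction a≡b a≢b
... | tri> _ _ b<a =
  (λ wa<wb → flip-< (a≢b ∘ perm-injective u ∘ sym) (FP.<-asym wa<wb ∘ proj₂ (w∼u b a b<a))) ,
  (λ ua<ub → flip-< (a≢b ∘ increasing⇒injective ι↑ ∘ perm-injective w ∘ sym) (FP.<-asym ua<ub ∘ proj₁ (w∼u b a b<a)))
  where
  flip-< : ∀ {m} {x y : Fin m} → toℕ y ≢ toℕ x → ¬ y F.< x → x F.< y
  flip-< y≢x y≮x = ≤∧≢⇒< (≮⇒≥ y≮x) (y≢x ∘ sym)

-- Both w ∘ ι and u are obtained from w′ ∘ ι′ and u′ by the same reindexing τ, so the relative order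
-- of any two entries is carried over.
pattern-transport : ∀ {n r} {w w′ : Perm n} {u u′ : Perm r} {ι ι′ : Fin r → Fin n} (τ : Perm r) →
  Increasing ι′ → PatternAt w′ u′ ι′ →
  (∀ x → w ⟨$⟩ʳ ι x ≡ w′ ⟨$⟩ʳ ι′ (τ ⟨$⟩ʳ x)) → (∀ x → u ⟨$⟩ʳ x ≡ u′ ⟨$⟩ʳ (τ ⟨$⟩ʳ x)) →
  PatternAt w u ι
pattern-transport {w′ = w′} {u′ = u′} {ι′ = ι′} τ ι′↑ w∼u w≡ u≡ a b a<b =
  (λ lt → subst₂ F._<_ (sym (u≡ a)) (sym (u≡ b)) (proj₁ τ-pattern (subst₂ F._<_ (w≡ a) (w≡ b) lt))) ,
  (λ lt → subst₂ F._<_ (sym (w≡ a)) (sym (w≡ b)) (proj₂ τ-pattern (subst₂ F._<_ (u≡ a) (u≡ b) lt)))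
  where
  τ-pattern = pattern-≢ {w = w′} {u′} {ι′} ι′↑ w∼u {τ ⟨$⟩ʳ a} {τ ⟨$⟩ʳ b} (FP.<⇒≢ a<b ∘ perm-injective τ ∘ cong toℕ)

module _ {n r j} (w′ : Perm n) {u′ : Perm r} (vj : InRange n (suc j)) {p q : Fin n}
         (w′p≡j : toℕ (w′ ⟨$⟩ʳ p) ≡ j) (w′q≡1+j : toℕ (w′ ⟨$⟩ʳ q) ≡ suc j) (p<q : p F.< q)
         (w′⊇u′ : Contains w′ u′) where

  private
    ι : Fin r → Fin n
    ι = proj₁ w′⊇u′

    ι↑ : Increasing ι
    ι↑ = proj₁ (proj₂ w′⊇u′) _ _

    w′∼u′ : PatternAt w′ u′ ι
    w′∼u′ = proj₂ (proj₂ w′⊇u′)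

    w : Perm n
    w = gen n (suc j) · w′

    w-toℕ : ∀ x → toℕ (w ⟨$⟩ʳ x) ≡ swapℕ (suc j) (toℕ (w′ ⟨$⟩ʳ x))
    w-toℕ x = gen-toℕ vj (w′ ⟨$⟩ʳ x)

    at-p : ∀ {x} → toℕ (w′ ⟨$⟩ʳ x) ≡ j → x ≡ p
    at-p e = perm-injective w′ (trans e (sym w′p≡j))

    at-q : ∀ {x} → toℕ (w′ ⟨$⟩ʳ x) ≡ suc j → x ≡ q
    at-q e = perm-injective w′ (trans e (sym w′q≡1+j))

  gen·-pattern-outside : (∀ a b → ¬ (ι a ≡ p × ι b ≡ q)) → PatternAt w u′ ι
  gen·-pattern-outside ¬pq a b a<b =
    (λ lt → proj₁ (w′∼u′ a b a<b) (swap-reflects-< j (subst₂ _<_ (w-toℕ (ι a)) (w-toℕ (ι b)) lt)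
                                     λ (a↦1+j , b↦j) → ¬pq b a (at-p b↦j , at-q a↦1+j))) ,
    (λ lt → subst₂ _<_ (sym (w-toℕ (ι a))) (sym (w-toℕ (ι b))) (swap-mono-< j (proj₂ (w′∼u′ a b a<b) lt)
                                     λ (a↦j , b↦1+j) → ¬pq a b (at-p a↦j , at-q b↦1+j)))

  module _ {j₁ j₂} (ιj₁≡p : ι j₁ ≡ p) (ιj₂≡q : ι j₂ ≡ q) where

    private
      W U : Fin r → ℕ
      W x = toℕ (w′ ⟨$⟩ʳ ι x)
      U x = toℕ (u′ ⟨$⟩ʳ x)

      Wj₁≡j : W j₁ ≡ j
      Wj₁≡j = trans (cong (toℕ ∘ (w′ ⟨$⟩ʳ_)) ιj₁≡p) w′p≡j

      Wj₂≡1+j : W j₂ ≡ suc j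
      Wj₂≡1+j = trans (cong (toℕ ∘ (w′ ⟨$⟩ʳ_)) ιj₂≡q) w′q≡1+j

      j₁<j₂ : j₁ F.< j₂
      j₁<j₂ = increasing-reflects-< ι↑ (subst₂ F._<_ (sym ιj₁≡p) (sym ιj₂≡q) p<q)

      k : ℕ
      k = U j₁

    -- A value of u′ strictly between k and U j₂ would match an entry of w′ strictly between j and j + 1.
    u′-adjacent : suc k ≡ U j₂
    u′-adjacent with suc k <? U j₂
    ... | no 1+k≮Uj₂ = ≤-antisym k<Uj₂ (≮⇒≥ 1+k≮Uj₂)
      where k<Uj₂ = proj₁ (w′∼u′ j₁ j₂ j₁<j₂) (subst₂ _<_ (sym Wj₁≡j) (sym Wj₂≡1+j) (n<1+n j))
    ... | yes 1+k<Uj₂ = contradiction (<-≤-trans Wt<1+j j<Wt) (<-irrefl refl)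
      where
      t,Ut≡1+k = preimage u′ (<-trans 1+k<Uj₂ (FP.toℕ<n (u′ ⟨$⟩ʳ j₂)))
      t = proj₁ t,Ut≡1+k
      Ut≡1+k = proj₂ t,Ut≡1+k
      j<Wt : j < W t
      j<Wt = subst (_< W t) Wj₁≡j (proj₂ (pattern-≢ {w = w′} {u′} ι↑ w′∼u′ (λ j₁≡t → <-irrefl (trans (cong U j₁≡t) Ut≡1+k) (n<1+n k)))
                                          (subst (k <_) (sym Ut≡1+k) (n<1+n k)))
      Wt<1+j : W t < suc j
      Wt<1+j = subst (W t <_) Wj₂≡1+j (proj₂ (pattern-≢ {w = w′} {u′} ι↑ w′∼u′ (λ t≡j₂ → <-irrefl (trans (sym Ut≡1+k) (cong U t≡j₂)) 1+k<Uj₂))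
                                          (subst (_< U j₂) (sym Ut≡1+k) 1+k<Uj₂))

    private
      vk : InRange r (suc k)
      vk = s≤s z≤n , subst (_< r) (sym u′-adjacent) (FP.toℕ<n (u′ ⟨$⟩ʳ j₂))

      -- u′⁻¹ s_{k+1} u′ exchanges the positions j₁ and j₂ of the occurrence.
      τ : Perm r
      τ = flip u′ · (gen r (suc k) · u′)

      Uτ : ∀ x → U (τ ⟨$⟩ʳ x) ≡ swapℕ (suc k) (U x)
      Uτ x = trans (cong toℕ (inverseʳ u′)) (gen-toℕ vk (u′ ⟨$⟩ʳ x))

      conjugate : ∀ {x v} → SwapView k (U x) v → U (τ ⟨$⟩ʳ x) ≡ v → swapℕ (suc j) (W x) ≡ W (τ ⟨$⟩ʳ x)
      conjugate {x} (at-j Ux≡k) Uτx≡1+k = begin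
        swapℕ (suc j) (W x)   ≡⟨ cong (swapℕ (suc j) ∘ W) (perm-injective u′ Ux≡k) ⟩
        swapℕ (suc j) (W j₁)  ≡⟨ cong (swapℕ (suc j)) Wj₁≡j ⟩
        swapℕ (suc j) j       ≡⟨ swap-j j ⟩
        suc j                 ≡⟨ Wj₂≡1+j ⟨
        W j₂                  ≡⟨ cong W (perm-injective u′ (trans Uτx≡1+k u′-adjacent)) ⟨
        W (τ ⟨$⟩ʳ x)          ∎
        where open ≡-Reasoning
      conjugate {x} (at-1+j Ux≡1+k) Uτx≡k = begin
        swapℕ (suc j) (W x)   ≡⟨ cong (swapℕ (suc j) ∘ W) (perm-injective u′ (trans Ux≡1+k u′-adjacent)) ⟩
        swapℕ (suc j) (W j₂)  ≡⟨ cong (swapℕ (suc j)) Wj₂≡1+j ⟩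
        swapℕ (suc j) (suc j) ≡⟨ swap-1+j j ⟩
        j                     ≡⟨ Wj₁≡j ⟨
        W j₁                  ≡⟨ cong W (perm-injective u′ Uτx≡k) ⟨
        W (τ ⟨$⟩ʳ x)          ∎
        where open ≡-Reasoning
      conjugate {x} (other Ux≢k Ux≢1+k) Uτx≡Ux = trans (swap-other j (W x) Wx≢j Wx≢1+j) (cong W (sym (perm-injective u′ Uτx≡Ux)))
        where
        Wx≢j : W x ≢ j
        Wx≢j Wx≡j = Ux≢k (cong U (increasing⇒injective ι↑ (trans (at-p Wx≡j) (sym ιj₁≡p))))
        Wx≢1+j : W x ≢ suc j
        Wx≢1+j Wx≡1+j = Ux≢1+k (trans (cong U (increasing⇒injective ι↑ (trans (at-q Wx≡1+j) (sym ιj₂≡q)))) (sym u′-adjacent))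

    gen·-pattern-inside : Σ ℕ λ b → InRange r b × (inversions (gen r b · u′) ≡ suc (inversions u′)) × PatternAt w (gen r b · u′) ι
    gen·-pattern-inside =
      suc k , vk , inversions-gen·-< u′ vk refl (sym u′-adjacent) j₁<j₂ ,
      pattern-transport {w = w} {w′} {gen r (suc k) · u′} {u′} {ι} {ι} τ ι↑ w′∼u′
        (λ x → toℕ-injective (trans (w-toℕ (ι x)) (conjugate (swap-view k (U x)) (Uτ x)))) (λ _ → sym (inverseʳ u′))

  gen·-contains : Contains w u′ ⊎
                  (Σ ℕ λ b → InRange r b × (inversions (gen r b · u′) ≡ suc (inversions u′)) × Contains w (gen r b · u′))
  gen·-contains with FP.any? (λ a → ι a F.≟ p) | FP.any? (λ b → ι b F.≟ q)
  ... | yes (_ , ιj₁≡p) | yes (_ , ιj₂≡q) =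
    let b , vb , inv≡ , w∼u = gen·-pattern-inside ιj₁≡p ιj₂≡q in inj₂ (b , vb , inv≡ , ι , (λ _ _ → ι↑) , w∼u)
  ... | no p∉ι | _       = inj₁ (ι , (λ _ _ → ι↑) , gen·-pattern-outside λ a _ (ιa≡p , _) → p∉ι (a , ιa≡p))
  ... | yes _  | no q∉ι  = inj₁ (ι , (λ _ _ → ι↑) , gen·-pattern-outside λ _ b (_ , ιb≡q) → q∉ι (b , ιb≡q))

module _ {n r j} (w′ : Perm n) {u′ : Perm r} (vj : InRange n (suc j)) {P Q : Fin n}
         (P≡j : toℕ P ≡ j) (Q≡1+j : toℕ Q ≡ suc j) (w′P<w′Q : w′ ⟨$⟩ʳ P F.< w′ ⟨$⟩ʳ Q)
         (w′⊇u′ : Contains w′ u′) where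

  private
    ι : Fin r → Fin n
    ι = proj₁ w′⊇u′

    ι↑ : Increasing ι
    ι↑ = proj₁ (proj₂ w′⊇u′) _ _

    w′∼u′ : PatternAt w′ u′ ι
    w′∼u′ = proj₂ (proj₂ w′⊇u′)

    g : Perm n
    g = gen n (suc j)

    g-toℕ : ∀ x → toℕ (g ⟨$⟩ʳ x) ≡ swapℕ (suc j) (toℕ x)
    g-toℕ = gen-toℕ vj

  ·gen-pattern-outside : (∀ a b → ¬ (ι a ≡ P × ι b ≡ Q)) →
                         Increasing ((g ⟨$⟩ʳ_) ∘ ι) × PatternAt (w′ · g) u′ ((g ⟨$⟩ʳ_) ∘ ι)
  ·gen-pattern-outside ¬PQ =
    (λ {a} {b} a<b → subst₂ _<_ (sym (g-toℕ (ι a))) (sym (g-toℕ (ι b))) (swap-mono-< j (ι↑ a<b)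
      λ (a↦j , b↦1+j) → ¬PQ a b (toℕ-injective (trans a↦j (sym P≡j)) , toℕ-injective (trans b↦1+j (sym Q≡1+j))))) ,
    pattern-transport {w = w′ · g} {w′} {u′} {u′} {(g ⟨$⟩ʳ_) ∘ ι} {ι} idₚ ι↑ w′∼u′
      (λ x → cong (w′ ⟨$⟩ʳ_) (gen-involutive n (suc j) (ι x))) (λ _ → refl)

  module _ {j₁ j₂} (ιj₁≡P : ι j₁ ≡ P) (ιj₂≡Q : ι j₂ ≡ Q) where

    private
      j₁<j₂ : j₁ F.< j₂
      j₁<j₂ = increasing-reflects-< ι↑ (subst₂ F._<_ (sym ιj₁≡P) (sym ιj₂≡Q) (subst₂ _<_ (sym P≡j) (sym Q≡1+j) (n<1+n j)))

      k : ℕ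
      k = toℕ j₁

    -- A position strictly between j₁ and j₂ would be sent by ι strictly between the positions j and j + 1.
    positions-adjacent : suc k ≡ toℕ j₂
    positions-adjacent with suc k <? toℕ j₂
    ... | no 1+k≮j₂ = ≤-antisym j₁<j₂ (≮⇒≥ 1+k≮j₂)
    ... | yes 1+k<j₂ = contradiction (<-≤-trans ιt<Q P<ιt) (<-irrefl refl)
      where
      t = fromℕ< (<-trans 1+k<j₂ (FP.toℕ<n j₂))
      t≡1+k = toℕ-fromℕ< (<-trans 1+k<j₂ (FP.toℕ<n j₂))
      P<ιt : suc j ≤ toℕ (ι t)
      P<ιt = subst (_< toℕ (ι t)) (trans (cong toℕ ιj₁≡P) P≡j) (ι↑ (subst (k <_) (sym t≡1+k) (n<1+n k)))
      ιt<Q : toℕ (ι t) < suc j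
      ιt<Q = subst (toℕ (ι t) <_) (trans (cong toℕ ιj₂≡Q) Q≡1+j) (ι↑ (subst (_< toℕ j₂) (sym t≡1+k) 1+k<j₂))

    private
      vk : InRange r (suc k)
      vk = s≤s z≤n , subst (_< r) (sym positions-adjacent) (FP.toℕ<n j₂)

      h : Perm r
      h = gen r (suc k)

      ιP≡ : toℕ (ι j₁) ≡ j
      ιP≡ = trans (cong toℕ ιj₁≡P) P≡j

      ιQ≡ : toℕ (ι j₂) ≡ suc j
      ιQ≡ = trans (cong toℕ ιj₂≡Q) Q≡1+j

      conjugate : ∀ {x v} → SwapView k (toℕ x) v → toℕ (h ⟨$⟩ʳ x) ≡ v → toℕ (g ⟨$⟩ʳ ι x) ≡ toℕ (ι (h ⟨$⟩ʳ x))
      conjugate {x} (at-j x≡k) hx≡1+k = begin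
        toℕ (g ⟨$⟩ʳ ι x)           ≡⟨ g-toℕ (ι x) ⟩
        swapℕ (suc j) (toℕ (ι x))  ≡⟨ cong (λ y → swapℕ (suc j) (toℕ (ι y))) (toℕ-injective x≡k) ⟩
        swapℕ (suc j) (toℕ (ι j₁)) ≡⟨ cong (swapℕ (suc j)) ιP≡ ⟩
        swapℕ (suc j) j            ≡⟨ swap-j j ⟩
        suc j                      ≡⟨ ιQ≡ ⟨
        toℕ (ι j₂)                 ≡⟨ cong (toℕ ∘ ι) (toℕ-injective (trans hx≡1+k positions-adjacent)) ⟨
        toℕ (ι (h ⟨$⟩ʳ x))         ∎
        where open ≡-Reasoning
      conjugate {x} (at-1+j x≡1+k) hx≡k = begin
        toℕ (g ⟨$⟩ʳ ι x)           ≡⟨ g-toℕ (ι x) ⟩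
        swapℕ (suc j) (toℕ (ι x))  ≡⟨ cong (λ y → swapℕ (suc j) (toℕ (ι y))) (toℕ-injective (trans x≡1+k positions-adjacent)) ⟩
        swapℕ (suc j) (toℕ (ι j₂)) ≡⟨ cong (swapℕ (suc j)) ιQ≡ ⟩
        swapℕ (suc j) (suc j)      ≡⟨ swap-1+j j ⟩
        j                          ≡⟨ ιP≡ ⟨
        toℕ (ι j₁)                 ≡⟨ cong (toℕ ∘ ι) (toℕ-injective hx≡k) ⟨
        toℕ (ι (h ⟨$⟩ʳ x))         ∎
        where open ≡-Reasoning
      conjugate {x} (other x≢k x≢1+k) hx≡x =
        trans (trans (g-toℕ (ι x)) (swap-other j _ ιx≢j ιx≢1+j)) (cong (toℕ ∘ ι) (sym (toℕ-injective hx≡x)))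
        where
        ιx≢j : toℕ (ι x) ≢ j
        ιx≢j ιx≡j = x≢k (cong toℕ (increasing⇒injective ι↑ (toℕ-injective (trans ιx≡j (sym ιP≡)))))
        ιx≢1+j : toℕ (ι x) ≢ suc j
        ιx≢1+j ιx≡1+j = x≢1+k (trans (cong toℕ (increasing⇒injective ι↑ (toℕ-injective (trans ιx≡1+j (sym ιQ≡))))) (sym positions-adjacent))

    ·gen-pattern-inside : Σ ℕ λ b → InRange r b × (inversions (u′ · gen r b) ≡ suc (inversions u′)) × PatternAt (w′ · g) (u′ · gen r b) ι
    ·gen-pattern-inside =
      suc k , vk , inversions-·gen-< u′ vk refl (sym positions-adjacent) (proj₁ (w′∼u′ j₁ j₂ j₁<j₂) w′ιj₁<w′ιj₂) ,
      pattern-transport {w = w′ · g} {w′} {u′ · h} {u′} {ι} {ι} h ι↑ w′∼u′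
        (λ x → cong (w′ ⟨$⟩ʳ_) (toℕ-injective (conjugate (swap-view k (toℕ x)) (gen-toℕ vk x)))) (λ _ → refl)
      where
      w′ιj₁<w′ιj₂ = subst₂ (λ a b → w′ ⟨$⟩ʳ a F.< w′ ⟨$⟩ʳ b) (sym ιj₁≡P) (sym ιj₂≡Q) w′P<w′Q

  ·gen-contains : Contains (w′ · g) u′ ⊎
                  (Σ ℕ λ b → InRange r b × (inversions (u′ · gen r b) ≡ suc (inversions u′)) × Contains (w′ · g) (u′ · gen r b))
  ·gen-contains with FP.any? (λ a → ι a F.≟ P) | FP.any? (λ b → ι b F.≟ Q)
  ... | yes (_ , ιj₁≡P) | yes (_ , ιj₂≡Q) =
    let b , vb , inv≡ , w∼u = ·gen-pattern-inside ιj₁≡P ιj₂≡Q in inj₂ (b , vb , inv≡ , ι , (λ _ _ → ι↑) , w∼u)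
  ... | no P∉ι | _ = let ι₂↑ , w∼u = ·gen-pattern-outside λ a _ (ιa≡P , _) → P∉ι (a , ιa≡P) in inj₁ (_ , (λ _ _ → ι₂↑) , w∼u)
  ... | yes _ | no Q∉ι = let ι₂↑ , w∼u = ·gen-pattern-outside λ _ b (_ , ιb≡Q) → Q∉ι (b , ιb≡Q) in inj₁ (_ , (λ _ _ → ι₂↑) , w∼u)

-- Peeling a reduced word down to the convex subheap

-- S_r sits in S_n as the permutations moving only c, …, c + r - 1.
module Shift {n r c : ℕ} (c+r≤n : c + r ≤ n) where

  shift-< : ∀ {y} → y < r → c + y < n
  shift-< y<r = <-≤-trans (+-monoʳ-< c y<r) c+r≤n

  shift : Fin r → Fin n
  shift x = fromℕ< (shift-< (FP.toℕ<n x))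

  toℕ-shift : ∀ x → toℕ (shift x) ≡ c + toℕ x
  toℕ-shift x = toℕ-fromℕ< (shift-< (FP.toℕ<n x))

  shift-inRange : ∀ {i} → InRange r i → InRange n (c + i)
  shift-inRange (1≤i , i<r) = ≤-trans 1≤i (m≤n+m _ c) , shift-< i<r

  shift-valid : ∀ {vs} → ValidWord r vs → ValidWord n (map (c +_) vs)
  shift-valid []         = []
  shift-valid (vi ∷ vvs) = shift-inRange vi ∷ shift-valid vvs

  shift-commute⇔ : ∀ {x y} → InRange r x → InRange r y → Commute r x y ⇔ Commute n (c + x) (c + y)
  shift-commute⇔ vx vy = mk⇔
    (λ commute → Equivalence.from (commute⇔¬adjacent (shift-inRange vx) (shift-inRange vy))
                   (Equivalence.to (commute⇔¬adjacent vx vy) commute ∘ +-adjacent c))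
    (λ commute → Equivalence.from (commute⇔¬adjacent vx vy)
                   (Equivalence.to (commute⇔¬adjacent (shift-inRange vx) (shift-inRange vy)) commute ∘ adjacent-+ c))

  swaps-shift : ∀ {vs} → ValidWord r vs → ∀ y → swaps (map (c +_) vs) (c + y) ≡ c + swaps vs y
  swaps-shift {[]}         []        y = refl
  swaps-shift {suc j ∷ vs} (_ ∷ vvs) y =
    trans (cong (swapℕ (c + suc j)) (swaps-shift vvs y)) (swap-+ c j (swaps vs y))

  swaps-outside : ∀ {vs} → ValidWord r vs → ∀ {y} → y < c ⊎ c + r ≤ y → swaps (map (c +_) vs) y ≡ y
  swaps-outside {[]}         []                 outside = refl
  swaps-outside {suc j ∷ vs} ((_ , 1+j<r) ∷ vvs) {y} outside = begin
    swapℕ (c + suc j) (swaps (map (c +_) vs) y) ≡⟨ cong (swapℕ (c + suc j)) (swaps-outside vvs outside) ⟩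
    swapℕ (c + suc j) y                         ≡⟨ cong (λ i → swapℕ i y) (+-suc c j) ⟩
    swapℕ (suc (c + j)) y                       ≡⟨ [ swap-fix-< (c + j) ∘ (λ y<c → <-≤-trans y<c (m≤m+n c j))
                                                   , swap-fix-> (c + j) ∘ <-≤-trans (subst (_< c + r) (+-suc c j) (+-monoʳ-< c 1+j<r))
                                                   ]′ outside ⟩
    y                                           ∎
    where open ≡-Reasoning

  prod-shift : ∀ {vs} → ValidWord r vs → ∀ x → toℕ (prod n (map (c +_) vs) ⟨$⟩ʳ shift x) ≡ c + toℕ (prod r vs ⟨$⟩ʳ x)
  prod-shift {vs} vvs x = begin
    toℕ (prod n (map (c +_) vs) ⟨$⟩ʳ shift x) ≡⟨ prod-toℕ (shift-valid vvs) (shift x) ⟩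
    swaps (map (c +_) vs) (toℕ (shift x))     ≡⟨ cong (swaps (map (c +_) vs)) (toℕ-shift x) ⟩
    swaps (map (c +_) vs) (c + toℕ x)         ≡⟨ swaps-shift vvs (toℕ x) ⟩
    c + swaps vs (toℕ x)                      ≡⟨ cong (c +_) (prod-toℕ vvs x) ⟨
    c + toℕ (prod r vs ⟨$⟩ʳ x)                ∎
    where open ≡-Reasoning

  prod-shift-outside : ∀ {vs} → ValidWord r vs → ∀ x → toℕ x < c ⊎ c + r ≤ toℕ x →
                       toℕ (prod n (map (c +_) vs) ⟨$⟩ʳ x) ≡ toℕ x
  prod-shift-outside vvs x outside = trans (prod-toℕ (shift-valid vvs) x) (swaps-outside vvs outside)

  prod-shift-cong : ∀ {vs us} → ValidWord r vs → ValidWord r us → prod r vs ≈ₚ prod r us →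
                    prod n (map (c +_) vs) ≈ₚ prod n (map (c +_) us)
  prod-shift-cong {vs} {us} vvs vus vs≈us x with toℕ x <? c | c + r ≤? toℕ x
  ... | yes x<c | _ = toℕ-injective (trans (prod-shift-outside vvs x (inj₁ x<c)) (sym (prod-shift-outside vus x (inj₁ x<c))))
  ... | no _ | yes c+r≤x = toℕ-injective (trans (prod-shift-outside vvs x (inj₂ c+r≤x)) (sym (prod-shift-outside vus x (inj₂ c+r≤x))))
  ... | no x≮c | no c+r≰x = toℕ-injective (begin
    toℕ (prod n (map (c +_) vs) ⟨$⟩ʳ x)      ≡⟨ cong (λ y → toℕ (prod n (map (c +_) vs) ⟨$⟩ʳ y)) x≡shift-z ⟩
    toℕ (prod n (map (c +_) vs) ⟨$⟩ʳ shift z) ≡⟨ prod-shift vvs z ⟩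
    c + toℕ (prod r vs ⟨$⟩ʳ z)                ≡⟨ cong (λ y → c + toℕ y) (vs≈us z) ⟩
    c + toℕ (prod r us ⟨$⟩ʳ z)                ≡⟨ prod-shift vus z ⟨
    toℕ (prod n (map (c +_) us) ⟨$⟩ʳ shift z) ≡⟨ cong (λ y → toℕ (prod n (map (c +_) us) ⟨$⟩ʳ y)) x≡shift-z ⟨
    toℕ (prod n (map (c +_) us) ⟨$⟩ʳ x)      ∎)
    where
    open ≡-Reasoning
    c+z≡x = m+[n∸m]≡n (≮⇒≥ x≮c)
    z = fromℕ< (+-cancelˡ-< c _ _ (subst (_< c + r) (sym c+z≡x) (≰⇒> c+r≰x)))
    x≡shift-z : x ≡ shift z
    x≡shift-z = toℕ-injective (sym (trans (toℕ-shift z) (trans (cong (c +_) (toℕ-fromℕ< _)) c+z≡x)))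

  shift-contains : ∀ {us} → ValidWord r us → Contains (prod n (map (c +_) us)) (prod r us)
  shift-contains vus = shift , shift↑ , λ a b _ →
    (λ lt → +-cancelˡ-< c _ _ (subst₂ _<_ (prod-shift vus a) (prod-shift vus b) lt)) ,
    (λ lt → subst₂ _<_ (sym (prod-shift vus a)) (sym (prod-shift vus b)) (+-monoʳ-< c lt))
    where
    shift↑ : ∀ a b → a F.< b → shift a F.< shift b
    shift↑ a b a<b = subst₂ _<_ (sym (toℕ-shift a)) (sym (toℕ-shift b)) (+-monoʳ-< c a<b)

  shift-reduced : ∀ {w us} → ValidWord r us → IsReducedExpr w (map (c +_) us) → IsReducedExpr (prod r us) us
  shift-reduced {w} {us} vus (_ , us≈w , minimal) = vus , (λ _ → refl) , λ vs vvs vs≈us → begin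
    length us               ≡⟨ length-map (c +_) us ⟨
    length (map (c +_) us)  ≤⟨ minimal (map (c +_) vs) (shift-valid vvs) (λ x → trans (prod-shift-cong vvs vus vs≈us x) (us≈w x)) ⟩
    length (map (c +_) vs)  ≡⟨ length-map (c +_) vs ⟩
    length vs               ∎
    where open ≤-Reasoning

private
  length-squeeze : ∀ {a b m} → a ≤ m → b ≤ suc a → b ≡ suc m → a ≡ m × a < b
  length-squeeze {a} a≤m b≤1+a refl = a≡m , subst (_< suc _) (sym a≡m) (n<1+n _)
    where a≡m = ≤-antisym a≤m (≤-pred b≤1+a)

reducedWord-∷⁻ : ∀ {n w i xs} → ReducedWord n w (i ∷ xs) →
  InRange n i × ReducedWord n (prod n xs) xs × inversions (prod n xs) < inversions (gen n i · prod n xs)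
reducedWord-∷⁻ {n} {w} {i} {xs} (reducedWord (vi ∷ vxs) ixs≈w length≡inv) =
  let length≡ , inv< = length-squeeze (inversions-≤-length vxs) (inversions-gen·-≤ (prod n xs) vi)
                                      (trans (inversions-cong {π = gen n i · prod n xs} {w} ixs≈w) (sym length≡inv))
  in vi , reducedWord vxs (λ _ → refl) (sym length≡) , inv<

reducedWord-∷ʳ⁻ : ∀ {n w i xs} → ReducedWord n w (xs ++ i ∷ []) →
  InRange n i × ReducedWord n (prod n xs) xs × inversions (prod n xs) < inversions (prod n xs · gen n i) × ((prod n xs · gen n i) ≈ₚ w)
reducedWord-∷ʳ⁻ {n} {w} {i} {xs} (reducedWord vxsi xsi≈w length≡inv) =
  let length≡ , inv< = length-squeeze (inversions-≤-length vxs) (inversions-·gen-≤ (prod n xs) vi)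
                                      (trans (inversions-cong {π = prod n xs · gen n i} {w} xs·i≈w)
                                             (trans (sym length≡inv) (trans (length-++ xs) (+-comm (length xs) 1))))
  in vi , reducedWord vxs (λ _ → refl) (sym length≡) , inv< , xs·i≈w
  where
  vxs = ++⁻ˡ xs vxsi
  vi = All.head (++⁻ʳ xs vxsi)
  xs·i≈w : (prod n xs · gen n i) ≈ₚ w
  xs·i≈w x = trans (sym (prod-++ n xs (i ∷ []) x)) (xsi≈w x)

-- Peeling the letters around the factor Cs = c + us off a reduced word of w, one at a time, while
-- keeping a pattern u of w with a reduced word containing us as a factor.
module Peel {n r c : ℕ} (c+r≤n : c + r ≤ n) {us : List ℕ} (vus : ValidWord r us) where

  open Shift {n} {r} {c} c+r≤n

  record FactorPattern (w : Perm n) : Set where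
    constructor factorPattern
    field
      pre post : List ℕ
      u        : Perm r
      reduced  : ReducedWord r u (pre ++ us ++ post)
      w⊇u      : Contains w u

  factorPattern-resp-≈ : ∀ {w w₁} → w ≈ₚ w₁ → FactorPattern w → FactorPattern w₁
  factorPattern-resp-≈ {w} {w₁} w≈w₁ (factorPattern pre post u red w⊇u) =
    factorPattern pre post u red (contains-respˡ-≈ {w = w} {w₁} {u} w≈w₁ w⊇u)

  extend-left : ∀ {w′ i} → InRange n i → inversions w′ < inversions (gen n i · w′) → FactorPattern w′ → FactorPattern (gen n i · w′)
  extend-left {i = zero} (() , _)
  extend-left {w′} {suc j} vj inv< (factorPattern pre post u red@(reducedWord vW W≈u |W|≡inv) w′⊇u)
    with preimage w′ (<-trans (n<1+n j) (proj₂ vj)) | preimage w′ (proj₂ vj)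
  ... | p , w′p≡j | q , w′q≡1+j with gen·-contains w′ {u} vj w′p≡j w′q≡1+j (gen·-ascent w′ vj w′p≡j w′q≡1+j inv<) w′⊇u
  ...   | inj₁ w⊇u = factorPattern pre post u red w⊇u
  ...   | inj₂ (b , vb , inv≡ , w⊇bu) =
    factorPattern (b ∷ pre) post (gen r b · u)
      (reducedWord (vb ∷ vW) (cong (gen r b ⟨$⟩ʳ_) ∘ W≈u) (trans (cong suc |W|≡inv) (sym inv≡))) w⊇bu

  extend-right : ∀ {w′ i} → InRange n i → inversions w′ < inversions (w′ · gen n i) → FactorPattern w′ → FactorPattern (w′ · gen n i)
  extend-right {i = zero} (() , _)
  extend-right {w′} {suc j} vj inv< (factorPattern pre post u red@(reducedWord vW W≈u |W|≡inv) w′⊇u)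
    with ·gen-contains w′ {u} vj P≡j Q≡1+j (·gen-ascent w′ vj P≡j Q≡1+j inv<) w′⊇u
    where
    P≡j = toℕ-fromℕ< (<-trans (n<1+n j) (proj₂ vj))
    Q≡1+j = toℕ-fromℕ< (proj₂ vj)
  ... | inj₁ w⊇u = factorPattern pre post u red w⊇u
  ... | inj₂ (b , vb , inv≡ , w⊇ub) =
    factorPattern pre (post ++ b ∷ []) (u · gen r b) (subst (ReducedWord r (u · gen r b)) (sym assoc) red′) w⊇ub
    where
    W = pre ++ us ++ post
    assoc : pre ++ us ++ post ++ b ∷ [] ≡ W ++ b ∷ []
    assoc = trans (cong (pre ++_) (sym (++-assoc us post (b ∷ [])))) (sym (++-assoc pre (us ++ post) (b ∷ [])))
    red′ : ReducedWord r (u · gen r b) (W ++ b ∷ [])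
    red′ = reducedWord (++⁺ vW (vb ∷ []))
             (λ x → trans (prod-++ r W (b ∷ []) x) (W≈u (gen r b ⟨$⟩ʳ x)))
             (trans (length-++ W) (trans (+-comm (length W) 1) (trans (cong suc |W|≡inv) (sym inv≡))))

  Cs : List ℕ
  Cs = map (c +_) us

  factorPattern-base : ∀ {w} → ReducedWord n w Cs → FactorPattern w
  factorPattern-base {w} Cs-reduced@(reducedWord _ Cs≈w _) =
    factorPattern [] [] (prod r us) (subst (ReducedWord r (prod r us)) (sym (++-identityʳ us)) us-reduced)
      (contains-respˡ-≈ {w = prod n Cs} {w} {prod r us} Cs≈w (shift-contains vus))
    where
    us-reduced : ReducedWord r (prod r us) us
    us-reduced = reducedWord vus (λ _ → refl)
      (reduced⇒length≡inversions {w = prod r us} (shift-reduced {w} vus (reducedWord⇒reduced Cs-reduced)))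

  peel-right : ∀ {Rs} → Reverse Rs → ∀ {w} → ReducedWord n w (Cs ++ Rs) → FactorPattern w
  peel-right []              {w} red = factorPattern-base (subst (ReducedWord n w) (++-identityʳ Cs) red)
  peel-right (Rs ∶ rev ∶ʳ i) {w} red =
    let vi , red′ , inv< , w≈ = reducedWord-∷ʳ⁻ {xs = Cs ++ Rs} (subst (ReducedWord n w) (sym (++-assoc Cs Rs (i ∷ []))) red)
    in factorPattern-resp-≈ w≈ (extend-right vi inv< (peel-right rev red′))

  peel : ∀ Ls Rs {w} → ReducedWord n w (Ls ++ Cs ++ Rs) → FactorPattern w
  peel []       Rs red = peel-right (reverseView Rs) red
  peel (i ∷ Ls) Rs red@(reducedWord _ ws≈w _) =
    let vi , red′ , inv< = reducedWord-∷⁻ red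
    in factorPattern-resp-≈ ws≈w (extend-left vi inv< (peel Ls Rs red′))

-- From heap containment to a pattern

module ConvexSubheap {n ws vs} (vws : ValidWord n ws) (sub : ConvexLabeledSubheap n vs ws) where

  open ConvexEmbedding (subheap⇒convexEmbedding {n} {vs} {ws} sub) public
    renaming (σ to φ; injective to φ-injective; label to φ-label; order to φ-order; convex to φ-convex)

  open ConvexRegions vws φ φ-convex public

  regroup-reducedWord : ∀ {w} → IsReducedExpr w ws → ReducedWord n w (regroup ws region)
  regroup-reducedWord {w} ws-reduced@(_ , ws≈w , _) = reducedWord
    (All-resp-↭ (↭-sym (regroup-↭ ws region)) vws)
    (λ x → trans (regroup-prod n ws region inversions-commute x) (ws≈w x))
    (trans (↭-length (regroup-↭ ws region)) (reduced⇒length≡inversions {w = w} ws-reduced))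

  vs↪Cs : ConvexEmbedding n n id vs Cs
  vs↪Cs = convexEmbedding ψ ψ-injective label order convex
    where
    ψ : Fin (length vs) → Fin (length Cs)
    ψ a = proj₁ (image⇒ρ-image a)
    ρψ≡φ : ∀ a → ρ (ψ a) ≡ φ a
    ρψ≡φ a = proj₂ (image⇒ρ-image a)
    ψ-injective : ∀ a b → ψ a ≡ ψ b → a ≡ b
    ψ-injective a b ψa≡ψb = φ-injective a b (trans (sym (ρψ≡φ a)) (trans (cong ρ ψa≡ψb) (ρψ≡φ b)))
    label : ∀ a → lookup Cs (ψ a) ≡ lookup vs a
    label a = trans (sym (lookup-selected ws _ (ψ a))) (trans (cong (lookup ws) (ρψ≡φ a)) (φ-label a))
    order : ∀ a b → (HeapLe n vs a b → HeapLe n Cs (ψ a) (ψ b)) × (HeapLe n Cs (ψ a) (ψ b) → HeapLe n vs a b)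
    order a b = (heapLe-ρ ∘ subst₂ (HeapLe n ws) (sym (ρψ≡φ a)) (sym (ρψ≡φ b)) ∘ proj₁ (φ-order a b)) ,
                (proj₂ (φ-order a b) ∘ subst₂ (HeapLe n ws) (ρψ≡φ a) (ρψ≡φ b) ∘ ρ-heapLe)
    convex : ∀ a b y → HeapLe n Cs (ψ a) y → HeapLe n Cs y (ψ b) → Σ (Fin (length vs)) λ c → ψ c ≡ y
    convex a b y ψa≤y y≤ψb =
      let c , φc≡ρy = φ-convex a b (ρ y) (subst (λ x → HeapLe n ws x (ρ y)) (ρψ≡φ a) (ρ-heapLe ψa≤y))
                                          (subst (HeapLe n ws (ρ y)) (ρψ≡φ b) (ρ-heapLe y≤ψb))
      in c , ρ-injective (trans (ρψ≡φ c) φc≡ρy)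

identity-coxeterEmbedding : ∀ r → IsOrientedCoxeterEmbedding r r id
identity-coxeterEmbedding r = (λ _ vi → vi) , (λ _ _ _ _ i≡j → i≡j) , (λ _ _ _ _ → id , id , id , id) , (λ _ _ _ _ i<j → i<j)

ShiftedLetter : ℕ → ℕ → ℕ → Set
ShiftedLetter c r y = Σ ℕ λ x → InRange r x × y ≡ c + x

module HeapFactor {n r c} (c+r≤n : c + r ≤ n) {ws hs f} (vws : ValidWord n ws) (vhs : ValidWord r hs)
                  (f≡c+ : ∀ i → InRange r i → f i ≡ c + i) (sub : ConvexLabeledSubheap n (map f hs) ws) where

  open ConvexSubheap {vs = map f hs} vws sub public
  open Shift {n} {r} {c} c+r≤n

  unshift : ∀ {y} → ShiftedLetter c r y → InRange r (y ∸ c) × c + (y ∸ c) ≡ y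
  unshift (x , vx , refl) = subst (InRange r) (sym (m+n∸m≡n c x)) vx , cong (c +_) (m+n∸m≡n c x)

  shifted-commute⇔ : ∀ {y₁ y₂} → ShiftedLetter c r y₁ → ShiftedLetter c r y₂ →
                     Commute n y₁ y₂ ⇔ Commute r (y₁ ∸ c) (y₂ ∸ c)
  shifted-commute⇔ (x₁ , v₁ , refl) (x₂ , v₂ , refl) rewrite m+n∸m≡n c x₁ | m+n∸m≡n c x₂ = ⇔.sym (shift-commute⇔ v₁ v₂)

  Cs-shifted : All (ShiftedLetter c r) Cs
  Cs-shifted = select-All ws _ λ k k-inside →
    let a , φa≡k = inside⇒image k (==⇒≡ _ inside k-inside)
    in subst (ShiftedLetter c r) (trans (sym (φ-label a)) (cong (lookup ws) φa≡k)) (All.lookup fhs-shifted (∈-lookup a))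
    where
    fhs-shifted : All (ShiftedLetter c r) (map f hs)
    fhs-shifted = map⁺ (All.map (λ {i} vi → i , vi , f≡c+ i vi) vhs)

  us : List ℕ
  us = map (_∸ c) Cs

  vus : ValidWord r us
  vus = map⁺ (All.map (proj₁ ∘ unshift) Cs-shifted)

  c+us≡Cs : map (c +_) us ≡ Cs
  c+us≡Cs = trans (sym (map-∘ Cs)) (map-id-local (All.map (proj₂ ∘ unshift) Cs-shifted))

  hs↪us : ConvexEmbedding r r id hs us
  hs↪us = convexEmbedding-relabel (convexEmbedding-∘ (convexEmbedding-∘ hs↪fhs vs↪Cs) Cs↪us)
            λ a → trans (cong (_∸ c) (f≡c+ _ (letter a))) (m+n∸m≡n c _)
    where
    letter : ∀ a → InRange r (lookup hs a)
    letter a = All.lookup vhs (∈-lookup a)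
    hs↪fhs : ConvexEmbedding r n f hs (map f hs)
    hs↪fhs = map-convexEmbedding f hs λ a b →
      subst₂ (λ x y → Commute r (lookup hs a) (lookup hs b) ⇔ Commute n x y)
             (sym (f≡c+ _ (letter a))) (sym (f≡c+ _ (letter b))) (shift-commute⇔ (letter a) (letter b))
    Cs↪us : ConvexEmbedding n r (_∸ c) Cs us
    Cs↪us = map-convexEmbedding (_∸ c) Cs λ i j →
      shifted-commute⇔ (All.lookup Cs-shifted (∈-lookup i)) (All.lookup Cs-shifted (∈-lookup j))

  factor-pattern : ∀ {w : Perm n} {h : Perm r} → IsReducedExpr w ws → IsReducedExpr h hs →
                   Σ (Perm r) λ u → HeapContains u h × Contains w u
  factor-pattern {w} ws-reduced hs-reduced
    with Peel.peel {n} {r} {c} c+r≤n vus Ls Rs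
           (subst (λ C → ReducedWord n w (Ls ++ C ++ Rs)) (sym c+us≡Cs) (regroup-reducedWord {w} ws-reduced))
    where
    Ls = part ws region below
    Rs = part ws region rest
  ... | Peel.factorPattern pre post u W-reduced w⊇u =
    u , (W , hs , id , reducedWord⇒reduced W-reduced , hs-reduced , identity-coxeterEmbedding r , hs↪W) , w⊇u
    where
    W = pre ++ us ++ post
    hs↪W : ConvexLabeledSubheap r (map id hs) W
    hs↪W = subst (λ vs → ConvexLabeledSubheap r vs W) (sym (map-id hs)) (convexEmbedding⇒subheap
             (convexEmbedding-∘ hs↪us (convexEmbedding-∘ (++-convexEmbedding us post) (++ʳ-convexEmbedding pre (us ++ post)))))

heapContains⇒pattern : ∀ {n r} {w : Perm n} {h : Perm r} → 1 ≤ n → HeapContains w h →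
                       Σ (Perm r) λ u → HeapContains u h × Contains w u
heapContains⇒pattern {n} {r} {w} {h} 1≤n (ws , hs , f , ws-reduced , hs-reduced , f-embedding , sub)
  with coxeterEmbedding-shift 1≤n f-embedding
... | c , c+r≤n , f≡c+ =
  HeapFactor.factor-pattern {n} {r} {c} c+r≤n {ws} {hs} {f} (proj₁ ws-reduced) (proj₁ hs-reduced) f≡c+ sub {w} {h}
                            ws-reduced hs-reduced

proposition4p1 : (P : PatternSet) (n : ℕ) (w : Perm n) (r : ℕ) (h : Perm r) →
    1 ≤ n → 1 ≤ r → Avoids P w → HeapContains w h →
    Σ (Perm r) λ u → InU P h u × Contains w u
proposition4p1 P n w r h 1≤n _ w-avoids w⊇h =
  let u , u⊇h , w⊇u = heapContains⇒pattern {w = w} {h} 1≤n w⊇h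
  in u , ((λ k p p∈P u⊇p → w-avoids k p p∈P (contains-trans {w = w} {u} {p} w⊇u u⊇p)) , u⊇h) , w⊇u
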